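{- Let $(\Gamma,\tau)$ be a $z$-oriented triangulation of a connected closed surface, with transition digraph $\Gamma_\tau$ and Markov chain $\mathcal{X}_\tau$. The following are equivalent: (1) $\mathcal{X}_\tau$ is aperiodic; (2) $\mathcal{X}_\tau$ is ergodic; (3) there exists a closed directed walk in $\Gamma_\tau$ whose length is not divisible by $3$.
   Context: A triangulation $\Gamma$ of a connected closed $2$-dimensional surface (not necessarily orientable) is a closed $2$-cell embedding of a connected finite simple graph in which every face is a triangle. Two edges are adjacent if distinct and lying in a common face. A zigzag is a cyclic sequence of edges $e_1,\dots,e_n$ (indices mod $n$, $n$ minimal) with $e_i,e_{i+1}$ adjacent, the faces containing $\{e_i,e_{i+1}\}$ and $\{e_{i+1},e_{i+2}\}$ adjacent (distinct, sharing an edge), and $e_i,e_{i+2}$ disjoint; as a cyclic vertex sequence $v_1,\dots,v_n$ with $e_i=v_iv_{i+1}$ it traverses $e_i$ from $v_i$ to $v_{i+1}$. A $z$-orientation $\tau$ contains exactly one of $Z,Z^{ -1}$ for each zigzag $Z$. Each edge is traversed exactly twice in total by the zigzags of $\tau$; it is of type I if in opposite directions, of type II (directed accordingly) if in the same direction. The transition digraph $\Gamma_\tau$ has vertex set $V$ of $\Gamma$, both directed edges $v\to w$, $w\to v$ for each type I edge $vw$, and the directed edge $v\to w$ for each type II edge directed from $v$ to $w$. The Markov chain $\mathcal{X}_\tau$ has state space $V$; with $d(v)$ = (number of type I edges at $v$) + 2·(number of type II edges directed out of $v$), the transition probability from $v_i$ to $v_j$ is $1/d(v_i)$ if $v_iv_j$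 is of type I, $2/d(v_i)$ if it is of type II directed from $v_i$ to $v_j$, and $0$ otherwise. Aperiodic means every state has period $1$ (gcd of lengths of closed walks through it); ergodic means irreducible and aperiodic. -}

module Defs where

open import Data.Nat as ℕ using (ℕ; zero; suc; _<_; _≡ᵇ_)
open import Data.Nat.Divisibility using (_∣_)
open import Data.Integer as ℤ using (ℤ; +_)
open import Data.Rational as ℚ using (ℚ; 0ℚ)
open import Data.Fin using (Fin; _≟_)
open import Data.Bool using (Bool; if_then_else_; _∧_)
open import Data.List using (List; length; filter; upTo; map; allFin; lookup)
open import Data.Nat.ListAction using (sum)
open import Data.List.Relation.Unary.Any using (Any)
open import Data.Product using (Σ; ∃; ∃-syntax; _×_; _,_)
open import Data.Sum using (_⊎_)
open import Relation.Nullary using (¬_)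
open import Relation.Nullary.Decidable using (_×-dec_)
open import Relation.Binary.PropositionalEquality using (_≡_; _≢_)
open import Relation.Binary.Construct.Closure.ReflexiveTransitive using (Star)

data Walk {A : Set} (R : A → A → Set) : A → A → ℕ → Set where
  []  : ∀ {x} → Walk R x x 0
  _∷_ : ∀ {x y z n} → R x y → Walk R y z n → Walk R x z (suc n)

IsSetGCD : (ℕ → Set) → ℕ → Set
IsSetGCD S g = (∀ ℓ → S ℓ → g ∣ ℓ) × (∀ d → (∀ ℓ → S ℓ → d ∣ ℓ) → d ∣ g)

ExactlyTwo : ∀ {n} → (Fin n → Set) → Set
ExactlyTwo {n} P = ∃[ f ] ∃[ g ] (f ≢ g × P f × P g × (∀ h → P h → h ≡ f ⊎ h ≡ g))

-- Triangulations of connected closed surfaces, given combinatorially: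
-- vertices Fin nV, triangular faces Fin nF with corner vertices fa, fb, fc.
-- The surface is obtained by gluing the triangles along common edges.

record Triangulation : Set where
  field
    nV nF : ℕ
    fa fb fc : Fin nF → Fin nV

  V : Set
  V = Fin nV

  Face : Set
  Face = Fin nF

  _∈F_ : V → Face → Set
  v ∈F f = v ≡ fa f ⊎ v ≡ fb f ⊎ v ≡ fc f

  -- graph adjacency: vw is an edge of Γ (every edge lies on a face)
  Adj : V → V → Set
  Adj v w = v ≢ w × ∃[ f ] (v ∈F f × w ∈F f)

  LinkStep : V → Face → Face → Set
  LinkStep v f g = v ∈F f × v ∈F g × ∃[ w ] (w ≢ v × w ∈F f × w ∈F g)

  field
    nonempty        : 0 < nV
    face-distinct   : ∀ f → fa f ≢ fb f × fb f ≢ fc f × fa f ≢ fc f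
    -- every edge lies on exactly two faces (closed surface, no boundary,
    -- and each pair of vertices spans at most one edge: simple graph)
    edge-two-faces  : ∀ v w → Adj v w → ExactlyTwo (λ f → v ∈F f × w ∈F f)
    vertex-on-face  : ∀ v → ∃[ f ] (v ∈F f)
    -- the faces around each vertex form a single cycle (surface, no pinching)
    link-connected  : ∀ v f g → v ∈F f → v ∈F g → Star (LinkStep v) f g
    connected       : ∀ v w → Star Adj v w

module _ (T : Triangulation) where
  open Triangulation T

  SameEdge : V → V → V → V → Set
  SameEdge a b c d = (a ≡ c × b ≡ d) ⊎ (a ≡ d × b ≡ c)

  EdgesAdj : V → V → V → V → Set
  EdgesAdj a b c d = ¬ SameEdge a b c d × ∃[ f ] (a ∈F f × b ∈F f × c ∈F f × d ∈F f)

  FacesAdj : Face → Face → Set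
  FacesAdj f g = f ≢ g × ∃[ u ] ∃[ w ] (u ≢ w × u ∈F f × w ∈F f × u ∈F g × w ∈F g)

  EdgesDisjoint : V → V → V → V → Set
  EdgesDisjoint a b c d = a ≢ c × a ≢ d × b ≢ c × b ≢ d

  -- A zigzag is a cyclic vertex sequence v_i (i ∈ ℤ, period n, n minimal),
  -- with edges e_i = v_i v_{i+1}.
  record IsZigzag (n : ℕ) (z : ℤ → V) : Set where
    field
      len-pos  : 0 < n
      periodic : ∀ i → z (i ℤ.+ + n) ≡ z i
      minimal  : ∀ p → 0 < p → p ℕ.< n → ¬ (∀ i → z (i ℤ.+ + p) ≡ z i)
      edges    : ∀ i → Adj (z i) (z (i ℤ.+ + 1))
      adjacent : ∀ i → EdgesAdj (z i) (z (i ℤ.+ + 1)) (z (i ℤ.+ + 1)) (z (i ℤ.+ + 2))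
      faces    : ∀ i → ∃[ f ] ∃[ g ]
                   ( (z i ∈F f × z (i ℤ.+ + 1) ∈F f × z (i ℤ.+ + 2) ∈F f)
                   × (z (i ℤ.+ + 1) ∈F g × z (i ℤ.+ + 2) ∈F g × z (i ℤ.+ + 3) ∈F g)
                   × FacesAdj f g )
      disjoint : ∀ i → EdgesDisjoint (z i) (z (i ℤ.+ + 1)) (z (i ℤ.+ + 2)) (z (i ℤ.+ + 3))

  record Zigzag : Set where
    field
      len : ℕ
      seq : ℤ → V
      isZigzag : IsZigzag len seq

  SameCyclic : (ℤ → V) → (ℤ → V) → Set
  SameCyclic s t = ∃[ k ] (∀ i → t i ≡ s (i ℤ.+ k))

  reverseSeq : (ℤ → V) → (ℤ → V)
  reverseSeq s i = s (ℤ.- i)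

  -- A z-orientation: a duplicate-free list of zigzags containing exactly one
  -- of Z, Z⁻¹ for every zigzag Z.
  record ZOrientation : Set where
    field
      zs : List Zigzag

    InOr : (ℤ → V) → Set
    InOr s = Any (λ Z → SameCyclic (Zigzag.seq Z) s) zs

    field
      no-dup : ∀ i j → i ≢ j →
               ¬ SameCyclic (Zigzag.seq (lookup zs i)) (Zigzag.seq (lookup zs j))
      choice : ∀ (Z : Zigzag) →
               (InOr (Zigzag.seq Z) ⊎ InOr (reverseSeq (Zigzag.seq Z)))
               × ¬ (InOr (Zigzag.seq Z) × InOr (reverseSeq (Zigzag.seq Z)))

module _ (T : Triangulation) (τ : ZOrientation T) where
  open Triangulation T
  open ZOrientation τ

  steps : Zigzag T → V → V → ℕ
  steps Z u v = length (filter (λ i → (Zigzag.seq Z (+ i) ≟ u) ×-dec (Zigzag.seq Z (+ i ℤ.+ + 1) ≟ v))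
                               (upTo (Zigzag.len Z)))

  trav : V → V → ℕ
  trav u v = sum (map (λ Z → steps Z u v) zs)

  TypeI : V → V → Set
  TypeI u v = trav u v ≡ 1 × trav v u ≡ 1

  TypeII : V → V → Set
  TypeII u v = trav u v ≡ 2 × trav v u ≡ 0

  Arc : V → V → Set
  Arc u v = TypeI u v ⊎ TypeII u v

  weight : V → V → ℕ
  weight u v =
    if (trav u v ≡ᵇ 1) ∧ (trav v u ≡ᵇ 1) then 1
    else if (trav u v ≡ᵇ 2) ∧ (trav v u ≡ᵇ 0) then 2
    else 0

  deg : V → ℕ
  deg u = sum (map (weight u) (allFin nV))

  prob : V → V → ℚ
  prob u v with deg u
  ... | zero  = 0ℚ
  ... | suc k = + weight u v ℚ./ suc k

  Trans : V → V → Set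
  Trans u v = 0ℚ ℚ.< prob u v

  ClosedLen : V → ℕ → Set
  ClosedLen v ℓ = 0 < ℓ × Walk Trans v v ℓ

  HasPeriod : V → ℕ → Set
  HasPeriod v p = IsSetGCD (ClosedLen v) p

  Aperiodic : Set
  Aperiodic = ∀ v → HasPeriod v 1

  Irreducible : Set
  Irreducible = ∀ u v → ∃[ ℓ ] Walk Trans u v ℓ

  Ergodic : Set
  Ergodic = Irreducible × Aperiodic

  HasNon3ClosedWalk : Set
  HasNon3ClosedWalk = ∃[ v ] ∃[ ℓ ] (Walk Arc v v ℓ × ¬ (3 ∣ ℓ))

-- A zigzag is determined by any three consecutive vertices, read forwards or backwards,
-- so stepping along zigzags permutes the finitely many corners (three consecutive vertices
-- of a face) and every corner lies on a zigzag. For an edge uv whose two faces have apexes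
-- c and d, a traversal u → v continues to c or to d, and exactly one of u v c and v u d
-- occurs in τ, because a zigzag through d u v c and its reverse cannot both belong to τ.
-- Hence trav u v + trav v u = 2 and every traversed pair is an arc of Γ_τ. Each face then
-- carries a directed 3-cycle of Γ_τ, so Γ_τ is strongly connected and every period divides 3:
-- the chain is aperiodic iff some closed walk has length prime to 3. Conversely, if all
-- closed walks had length divisible by 3, the depth from a root would increase by 1 mod 3
-- along every arc. Aperiodicity alone forces an arc, hence a zigzag, to exist, which excludes
-- the degenerate two-triangle sphere and gives irreducibility.

module Submission where

open import Defs
open import Data.Nat as ℕ using (ℕ; zero; suc; _+_; _<_; _≤_; z≤n; s≤s; _≡ᵇ_)
import Data.Nat.Properties as ℕP
open import Algebra.Properties.CommutativeSemigroup ℕP.+-commutativeSemigroup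
  using () renaming (interchange to +-interchange)
open import Data.Nat.Induction using (<-rec)
open import Data.Nat.ListAction using (sum)
open import Data.Nat.DivMod using (_%_; %-distribˡ-+; [m+kn]%n≡m%n; m*n%n≡0)
open import Data.Nat.Divisibility
  using (_∣_; _∣?_; ∣m+n∣m⇒∣n; 0∣⇒≡0; ∣1⇒≡1; 1∣_; _∣0; m%n≡0⇒n∣m; n∣m⇒m%n≡0)
open import Data.Nat.Primality using (Prime; prime?; prime⇒irreducible)
import Data.Nat.Tactic.RingSolver as ℕ-Solver
open import Data.Integer as ℤ using (ℤ; +_; -[1+_])
import Data.Integer.Properties as ℤP
open import Data.Integer.DivMod using (a≡a%ℕn+[a/ℕn]*n; n%ℕd<d)
open import Data.Integer.Tactic.RingSolver using (solve-∀)
open import Data.Rational as ℚ using (0ℚ)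
import Data.Rational.Properties as ℚP
open import Data.Fin as F using (Fin; _≟_; toℕ)
import Data.Fin.Properties as FP
open import Data.List using (List; []; _∷_; [_]; _++_; length; filter; upTo; map; lookup)
import Data.List.Properties as LP
open import Data.List.Relation.Unary.Any using (Any; here; there)
open import Data.List.Membership.Propositional using (_∈_)
open import Data.List.Membership.Propositional.Properties using (∈-allFin)
open import Data.Bool using (if_then_else_; _∧_)
open import Data.Product using (∃-syntax; _×_; _,_; proj₁; proj₂)
open import Data.Sum using (_⊎_; inj₁; inj₂; [_,_]′)
open import Data.Empty using (⊥; ⊥-elim)
open import Function using (_∘′_)
open import Function.Bundles using (_⇔_; mk⇔)
open import Relation.Nullary using (¬_; Dec; yes; no; ¬?)
open import Relation.Nullary.Decidable using (_×-dec_; _⊎-dec_; map′; toWitness)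
open import Relation.Unary using (Decidable)
open import Relation.Binary.Definitions using (tri<; tri≈; tri>)
open import Relation.Binary.PropositionalEquality
  using (_≡_; _≢_; refl; sym; trans; cong; cong₂; subst; subst₂; ≢-sym; module ≡-Reasoning)
open import Relation.Binary.Construct.Closure.ReflexiveTransitive using (Star; ε; _◅_)

private
  variable
    A : Set

Among3 : A → A → A → A → Set
Among3 x p q r = x ≡ p ⊎ x ≡ q ⊎ x ≡ r

module _ {x p q r : A} where

  among3-≢₂⇒≡₃ : Among3 x p q r → x ≢ p → x ≢ q → x ≡ r
  among3-≢₂⇒≡₃ (inj₁ e)         x≢p _   = ⊥-elim (x≢p e)
  among3-≢₂⇒≡₃ (inj₂ (inj₁ e))  _   x≢q = ⊥-elim (x≢q e)
  among3-≢₂⇒≡₃ (inj₂ (inj₂ e))  _   _   = e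

  among3-≢₂⇒≡₂ : Among3 x p q r → x ≢ p → x ≢ r → x ≡ q
  among3-≢₂⇒≡₂ (inj₁ e)         x≢p _   = ⊥-elim (x≢p e)
  among3-≢₂⇒≡₂ (inj₂ (inj₁ e))  _   _   = e
  among3-≢₂⇒≡₂ (inj₂ (inj₂ e))  _   x≢r = ⊥-elim (x≢r e)

  among3-≢₂⇒≡₁ : Among3 x p q r → x ≢ q → x ≢ r → x ≡ p
  among3-≢₂⇒≡₁ (inj₁ e)         _   _   = e
  among3-≢₂⇒≡₁ (inj₂ (inj₁ e))  x≢q _   = ⊥-elim (x≢q e)
  among3-≢₂⇒≡₁ (inj₂ (inj₂ e))  _   x≢r = ⊥-elim (x≢r e)

among3-swap : ∀ {x p q r : A} → Among3 x p q r → Among3 x p r q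
among3-swap (inj₁ e)        = inj₁ e
among3-swap (inj₂ (inj₁ e)) = inj₂ (inj₂ e)
among3-swap (inj₂ (inj₂ e)) = inj₂ (inj₁ e)

among3-third-unique : ∀ {p q r a b x y : A} →
  Among3 a p q r → Among3 b p q r → a ≢ b →
  Among3 x p q r → x ≢ a → x ≢ b → Among3 y p q r → y ≢ a → y ≢ b → x ≡ y
among3-third-unique (inj₁ refl)         (inj₁ refl)         a≢b _  _   _   _  _   _   = ⊥-elim (a≢b refl)
among3-third-unique (inj₁ refl)         (inj₂ (inj₁ refl))  _   hx x≢a x≢b hy y≢a y≢b =
  trans (among3-≢₂⇒≡₃ hx x≢a x≢b) (sym (among3-≢₂⇒≡₃ hy y≢a y≢b))
among3-third-unique (inj₁ refl)         (inj₂ (inj₂ refl))  _   hx x≢a x≢b hy y≢a y≢b =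
  trans (among3-≢₂⇒≡₂ hx x≢a x≢b) (sym (among3-≢₂⇒≡₂ hy y≢a y≢b))
among3-third-unique (inj₂ (inj₁ refl))  (inj₁ refl)         _   hx x≢a x≢b hy y≢a y≢b =
  trans (among3-≢₂⇒≡₃ hx x≢b x≢a) (sym (among3-≢₂⇒≡₃ hy y≢b y≢a))
among3-third-unique (inj₂ (inj₁ refl))  (inj₂ (inj₁ refl))  a≢b _  _   _   _  _   _   = ⊥-elim (a≢b refl)
among3-third-unique (inj₂ (inj₁ refl))  (inj₂ (inj₂ refl))  _   hx x≢a x≢b hy y≢a y≢b =
  trans (among3-≢₂⇒≡₁ hx x≢a x≢b) (sym (among3-≢₂⇒≡₁ hy y≢a y≢b))
among3-third-unique (inj₂ (inj₂ refl))  (inj₁ refl)         _   hx x≢a x≢b hy y≢a y≢b =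
  trans (among3-≢₂⇒≡₂ hx x≢b x≢a) (sym (among3-≢₂⇒≡₂ hy y≢b y≢a))
among3-third-unique (inj₂ (inj₂ refl))  (inj₂ (inj₁ refl))  _   hx x≢a x≢b hy y≢a y≢b =
  trans (among3-≢₂⇒≡₁ hx x≢b x≢a) (sym (among3-≢₂⇒≡₁ hy y≢b y≢a))
among3-third-unique (inj₂ (inj₂ refl))  (inj₂ (inj₂ refl))  a≢b _  _   _   _  _   _   = ⊥-elim (a≢b refl)

among3-no-four : ∀ {p q r a b c d : A} →
  Among3 a p q r → Among3 b p q r → Among3 c p q r → Among3 d p q r →
  a ≢ b → a ≢ c → a ≢ d → b ≢ c → b ≢ d → c ≢ d → ⊥
among3-no-four ha hb hc hd a≢b a≢c a≢d b≢c b≢d c≢d =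
  c≢d (among3-third-unique ha hb a≢b hc (≢-sym a≢c) (≢-sym b≢c) hd (≢-sym a≢d) (≢-sym b≢d))

m+n≡2-cases : ∀ {m n} → m + n ≡ 2 → 0 < m → (m ≡ 1 × n ≡ 1) ⊎ (m ≡ 2 × n ≡ 0)
m+n≡2-cases {suc zero}          {suc zero}    _  _ = inj₁ (refl , refl)
m+n≡2-cases {suc (suc zero)}    {zero}        _  _ = inj₂ (refl , refl)
m+n≡2-cases {suc zero}          {zero}        () _
m+n≡2-cases {suc zero}          {suc (suc _)} () _
m+n≡2-cases {suc (suc zero)}    {suc _}       () _
m+n≡2-cases {suc (suc (suc _))}               () _

%-cancelˡ-+ : ∀ a b c m .{{_ : ℕ.NonZero m}} → (a + b) % m ≡ (a + c) % m → b % m ≡ c % m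
%-cancelˡ-+ a b c m@(suc m′) a+b≡a+c = begin
  b % m                                   ≡⟨ [m+kn]%n≡m%n b a m ⟨
  (b + a ℕ.* m) % m                       ≡⟨ cong (_% m) (regroup a b) ⟩
  (a ℕ.* m′ + (a + b)) % m                ≡⟨ %-distribˡ-+ (a ℕ.* m′) (a + b) m ⟩
  (a ℕ.* m′ % m + (a + b) % m) % m        ≡⟨ cong (λ x → (a ℕ.* m′ % m + x) % m) a+b≡a+c ⟩
  (a ℕ.* m′ % m + (a + c) % m) % m        ≡⟨ %-distribˡ-+ (a ℕ.* m′) (a + c) m ⟨
  (a ℕ.* m′ + (a + c)) % m                ≡⟨ cong (_% m) (regroup a c) ⟨
  (c + a ℕ.* m) % m                       ≡⟨ [m+kn]%n≡m%n c a m ⟩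
  c % m                                   ∎
  where
    open ≡-Reasoning
    regroup : ∀ a b → b + a ℕ.* suc m′ ≡ a ℕ.* m′ + (a + b)
    regroup a b = ring m′ a b
      where
        ring : ∀ m′ a b → b + a ℕ.* (1 + m′) ≡ a ℕ.* m′ + (a + b)
        ring = ℕ-Solver.solve-∀

%-cancelʳ-+ : ∀ a b c m .{{_ : ℕ.NonZero m}} → (b + a) % m ≡ (c + a) % m → b % m ≡ c % m
%-cancelʳ-+ a b c m b+a≡c+a =
  %-cancelˡ-+ a b c m (trans (cong (_% m) (ℕP.+-comm a b)) (trans b+a≡c+a (cong (_% m) (ℕP.+-comm c a))))

∣prime∧∣∧prime∤⇒∣1 : ∀ {p d n} → Prime p → d ∣ p → d ∣ n → ¬ p ∣ n → d ∣ 1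
∣prime∧∣∧prime∤⇒∣1 p-prime d∣p d∣n p∤n with prime⇒irreducible p-prime d∣p
... | inj₁ refl = 1∣ 1
... | inj₂ refl = ⊥-elim (p∤n d∣n)

least-witness : ∀ {P : ℕ → Set} → Decidable P → ∀ {n} → P n → ∃[ m ] (P m × (∀ k → k < m → ¬ P k))
least-witness {P} P? {n} = <-rec Goal search n
  where
    Goal : ℕ → Set
    Goal n = P n → ∃[ m ] (P m × (∀ k → k < m → ¬ P k))
    search : ∀ n → (∀ {m} → m < n → Goal m) → Goal n
    search n rec pn with ℕP.anyUpTo? P? n
    ... | yes (m , m<n , pm) = rec m<n pm
    ... | no none            = n , pn , λ k k<n pk → none (k , k<n , pk)

ℤ-induction : (P : ℤ → Set) → P (+ 0) →
  (∀ m → P m → P (ℤ.suc m)) → (∀ m → P m → P (ℤ.pred m)) → ∀ m → P m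
ℤ-induction P p₀ up down (+ zero)     = p₀
ℤ-induction P p₀ up down (+ suc k)    = up (+ k) (ℤ-induction P p₀ up down (+ k))
ℤ-induction P p₀ up down -[1+ zero ]  = down (+ 0) p₀
ℤ-induction P p₀ up down -[1+ suc k ] = down -[1+ k ] (ℤ-induction P p₀ up down -[1+ k ])

module _ {P : ℕ → Set} (P? : Decidable P) where

  countBelow : ℕ → ℕ
  countBelow zero = 0
  countBelow (suc n) with P? n
  ... | yes _ = suc (countBelow n)
  ... | no _  = countBelow n

  length-filter-upTo : ∀ n → length (filter P? (upTo n)) ≡ countBelow n
  length-filter-upTo zero    = refl
  length-filter-upTo (suc n) = begin
    length (filter P? (upTo (suc n)))                    ≡⟨ cong (length ∘′ filter P?) (LP.upTo-∷ʳ n) ⟨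
    length (filter P? (upTo n ++ [ n ]))                 ≡⟨ cong length (LP.filter-++ P? (upTo n) [ n ]) ⟩
    length (filter P? (upTo n) ++ filter P? [ n ])       ≡⟨ LP.length-++ (filter P? (upTo n)) ⟩
    length (filter P? (upTo n)) + length (filter P? [ n ]) ≡⟨ cong (_+ length (filter P? [ n ])) (length-filter-upTo n) ⟩
    countBelow n + length (filter P? [ n ])              ≡⟨ last n ⟩
    countBelow (suc n)                                   ∎
    where
      open ≡-Reasoning
      last : ∀ n → countBelow n + length (filter P? [ n ]) ≡ countBelow (suc n)
      last n with P? n
      ... | yes _ = ℕP.+-comm (countBelow n) 1
      ... | no _  = ℕP.+-identityʳ (countBelow n)

  countBelow-pos : ∀ {n i} → i < n → P i → 0 < countBelow n
  countBelow-pos {suc n} {i} i<1+n pi with P? n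
  ... | yes _  = ℕP.0<1+n
  ... | no ¬pn with ℕP.m<1+n⇒m<n∨m≡n i<1+n
  ...   | inj₁ i<n  = countBelow-pos i<n pi
  ...   | inj₂ refl = ⊥-elim (¬pn pi)

  countBelow-witness : ∀ n → 0 < countBelow n → ∃[ i ] (i < n × P i)
  countBelow-witness (suc n) pos with P? n
  ... | yes pn = n , ℕP.n<1+n n , pn
  ... | no _   with countBelow-witness n pos
  ...   | i , i<n , pi = i , ℕP.m<n⇒m<1+n i<n , pi

  countBelow-none : ∀ n → (∀ i → i < n → ¬ P i) → countBelow n ≡ 0
  countBelow-none zero    none = refl
  countBelow-none (suc n) none with P? n
  ... | yes pn = ⊥-elim (none n (ℕP.n<1+n n) pn)
  ... | no _   = countBelow-none n (λ i i<n → none i (ℕP.m<n⇒m<1+n i<n))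

  countBelow-≤1 : ∀ n → (∀ {i j} → i < n → j < n → P i → P j → i ≡ j) → countBelow n ≤ 1
  countBelow-≤1 zero    uniq = z≤n
  countBelow-≤1 (suc n) uniq with P? n
  ... | yes pn = s≤s (ℕP.≤-reflexive (countBelow-none n λ i i<n pi →
                   ℕP.<-irrefl (uniq (ℕP.m<n⇒m<1+n i<n) (ℕP.n<1+n n) pi pn) i<n))
  ... | no _   = countBelow-≤1 n λ i<n j<n → uniq (ℕP.m<n⇒m<1+n i<n) (ℕP.m<n⇒m<1+n j<n)

module _ {P Q R : ℕ → Set} (P? : Decidable P) (Q? : Decidable Q) (R? : Decidable R) where

  countBelow-split : (∀ {i} → P i → Q i ⊎ R i) → (∀ {i} → Q i → P i) → (∀ {i} → R i → P i) →
    (∀ {i} → Q i → R i → ⊥) → ∀ n → countBelow P? n ≡ countBelow Q? n + countBelow R? n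
  countBelow-split split fromQ fromR disjoint = go
    where
      go : ∀ n → countBelow P? n ≡ countBelow Q? n + countBelow R? n
      go zero = refl
      go (suc n) with P? n | Q? n | R? n
      ... | _      | yes q | yes r = ⊥-elim (disjoint q r)
      ... | yes _  | yes _ | no _  = cong suc (go n)
      ... | yes _  | no _  | yes _ = trans (cong suc (go n)) (sym (ℕP.+-suc _ _))
      ... | yes p  | no ¬q | no ¬r = ⊥-elim ([ ¬q , ¬r ]′ (split p))
      ... | no ¬p  | yes q | _     = ⊥-elim (¬p (fromQ q))
      ... | no ¬p  | no _  | yes r = ⊥-elim (¬p (fromR r))
      ... | no _   | no _  | no _  = go n

module _ {A : Set} where

  sum-map-+ : (xs : List A) (f g : A → ℕ) → sum (map (λ x → f x + g x) xs) ≡ sum (map f xs) + sum (map g xs)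
  sum-map-+ []       f g = refl
  sum-map-+ (x ∷ xs) f g = begin
    (f x + g x) + sum (map (λ x → f x + g x) xs)    ≡⟨ cong (_+_ (f x + g x)) (sum-map-+ xs f g) ⟩
    (f x + g x) + (sum (map f xs) + sum (map g xs)) ≡⟨ +-interchange (f x) (g x) _ _ ⟩
    (f x + sum (map f xs)) + (g x + sum (map g xs)) ∎
    where open ≡-Reasoning

  sum-map-cong : (xs : List A) {f g : A → ℕ} → (∀ x → f x ≡ g x) → sum (map f xs) ≡ sum (map g xs)
  sum-map-cong xs f≗g = cong sum (LP.map-cong f≗g xs)

  lookup≤sum-map : (xs : List A) (f : A → ℕ) (k : Fin (length xs)) → f (lookup xs k) ≤ sum (map f xs)
  lookup≤sum-map (x ∷ xs) f F.zero    = ℕP.m≤m+n _ _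
  lookup≤sum-map (x ∷ xs) f (F.suc k) = ℕP.≤-trans (lookup≤sum-map xs f k) (ℕP.m≤n+m _ (f x))

  ∈⇒≤sum-map : (f : A → ℕ) {x : A} {xs : List A} → x ∈ xs → f x ≤ sum (map f xs)
  ∈⇒≤sum-map f (here refl)           = ℕP.m≤m+n _ _
  ∈⇒≤sum-map f {xs = y ∷ _} (there p) = ℕP.≤-trans (∈⇒≤sum-map f p) (ℕP.m≤n+m _ (f y))

  sum-map-pos : (xs : List A) (f : A → ℕ) → 0 < sum (map f xs) → ∃[ k ] (0 < f (lookup xs k))
  sum-map-pos (x ∷ xs) f pos with f x in eq
  ... | suc _ = F.zero , subst (0 <_) (sym eq) ℕP.0<1+n
  ... | zero with sum-map-pos xs f pos
  ...   | k , fk>0 = F.suc k , fk>0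

  sum-map-zero : (xs : List A) (f : A → ℕ) → (∀ k → f (lookup xs k) ≡ 0) → sum (map f xs) ≡ 0
  sum-map-zero []       f zeros = refl
  sum-map-zero (x ∷ xs) f zeros = cong₂ _+_ (zeros F.zero) (sum-map-zero xs f (λ k → zeros (F.suc k)))

  sum-map-≡1 : (xs : List A) (f : A → ℕ) → (∀ k → f (lookup xs k) ≤ 1) →
    (∀ k k′ → 0 < f (lookup xs k) → 0 < f (lookup xs k′) → k ≡ k′) →
    ∃[ k ] (0 < f (lookup xs k)) → sum (map f xs) ≡ 1
  sum-map-≡1 (x ∷ xs) f ≤1 uniq (F.zero , pos) =
    cong₂ _+_ (ℕP.≤-antisym (≤1 F.zero) pos)
      (sum-map-zero xs f λ k → ℕP.n≤0⇒n≡0 (ℕP.≮⇒≥ λ pos′ → zero≢suc (uniq F.zero (F.suc k) pos pos′)))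
    where
      zero≢suc : ∀ {n} {k : Fin n} → F.zero ≢ F.suc k
      zero≢suc ()
  sum-map-≡1 (x ∷ xs) f ≤1 uniq (F.suc k , pos) =
    cong₂ _+_ (ℕP.n≤0⇒n≡0 (ℕP.≮⇒≥ λ pos′ → suc≢zero (uniq (F.suc k) F.zero pos pos′)))
      (sum-map-≡1 xs f (λ k → ≤1 (F.suc k)) (λ j j′ p q → FP.suc-injective (uniq (F.suc j) (F.suc j′) p q)) (k , pos))
    where
      suc≢zero : ∀ {n} {k : Fin n} → F.suc k ≢ F.zero
      suc≢zero ()

  Any⇒lookup : ∀ {P : A → Set} {xs : List A} → Any P xs → ∃[ k ] P (lookup xs k)
  Any⇒lookup (here p)  = F.zero , p
  Any⇒lookup (there a) with Any⇒lookup a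
  ... | k , p = F.suc k , p

  lookup⇒Any : ∀ {P : A → Set} (xs : List A) (k : Fin (length xs)) → P (lookup xs k) → Any P xs
  lookup⇒Any (x ∷ xs) F.zero    p = here p
  lookup⇒Any (x ∷ xs) (F.suc k) p = there (lookup⇒Any xs k p)

module _ {A : Set} (F : ℕ → A) (N : ℕ) .{{_ : ℕ.NonZero N}} (F-periodic : ∀ k → F (k + N) ≡ F k) where

  periodic-multiple : ∀ x t → F (x + t ℕ.* N) ≡ F x
  periodic-multiple x zero    = cong F (ℕP.+-identityʳ x)
  periodic-multiple x (suc t) = begin
    F (x + (N + t ℕ.* N))  ≡⟨ cong F (trans (cong (_+_ x) (ℕP.+-comm N (t ℕ.* N))) (sym (ℕP.+-assoc x _ N))) ⟩
    F (x + t ℕ.* N + N)    ≡⟨ F-periodic _ ⟩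
    F (x + t ℕ.* N)        ≡⟨ periodic-multiple x t ⟩
    F x                    ∎
    where open ≡-Reasoning

  periodic-congruent : ∀ x y t → + x ≡ + y ℤ.+ t ℤ.* + N → F x ≡ F y
  periodic-congruent x y (+ t) x≡y+tN =
    trans (cong F (ℤP.+-injective (trans x≡y+tN (cong (ℤ._+_ (+ y)) (sym (ℤP.pos-* t N)))))) (periodic-multiple y t)
  periodic-congruent x y -[1+ t ] x≡y-tN = sym (periodic-congruent y x (+ suc t) (begin
    + y                                       ≡⟨ ℓ (+ y) -[1+ t ] (+ N) ⟩
    (+ y ℤ.+ -[1+ t ] ℤ.* + N) ℤ.+ + suc t ℤ.* + N ≡⟨ cong (ℤ._+ + suc t ℤ.* + N) x≡y-tN ⟨
    + x ℤ.+ + suc t ℤ.* + N                   ∎))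
    where
      open ≡-Reasoning
      ℓ : ∀ y t n → y ≡ (y ℤ.+ t ℤ.* n) ℤ.+ (ℤ.- t) ℤ.* n
      ℓ = solve-∀

  periodicℤ : ℤ → A
  periodicℤ a = F (a ℤ.%ℕ N)

  periodicℤ-+ : ∀ a k → periodicℤ (a ℤ.+ + k) ≡ F (a ℤ.%ℕ N + k)
  periodicℤ-+ a k = periodic-congruent _ _ (a ℤ./ℕ N ℤ.- (a ℤ.+ + k) ℤ./ℕ N) (begin
    + r′                                          ≡⟨ ℓ₁ (+ r′) q′ (+ N) ⟩
    (+ r′ ℤ.+ q′ ℤ.* + N) ℤ.- q′ ℤ.* + N          ≡⟨ cong (ℤ._- q′ ℤ.* + N) (a≡a%ℕn+[a/ℕn]*n (a ℤ.+ + k) N) ⟨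
    (a ℤ.+ + k) ℤ.- q′ ℤ.* + N                    ≡⟨ cong (λ b → (b ℤ.+ + k) ℤ.- q′ ℤ.* + N) (a≡a%ℕn+[a/ℕn]*n a N) ⟩
    ((+ r ℤ.+ q ℤ.* + N) ℤ.+ + k) ℤ.- q′ ℤ.* + N  ≡⟨ ℓ₂ (+ r) q (+ k) q′ (+ N) ⟩
    + (r + k) ℤ.+ (q ℤ.- q′) ℤ.* + N              ∎)
    where
      open ≡-Reasoning
      r = a ℤ.%ℕ N
      q = a ℤ./ℕ N
      r′ = (a ℤ.+ + k) ℤ.%ℕ N
      q′ = (a ℤ.+ + k) ℤ./ℕ N
      ℓ₁ : ∀ r q n → r ≡ (r ℤ.+ q ℤ.* n) ℤ.- q ℤ.* n
      ℓ₁ = solve-∀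
      ℓ₂ : ∀ r q k q′ n → ((r ℤ.+ q ℤ.* n) ℤ.+ k) ℤ.- q′ ℤ.* n ≡ (r ℤ.+ k) ℤ.+ (q ℤ.- q′) ℤ.* n
      ℓ₂ = solve-∀

module _ {A : Set} (s : ℤ → A) (L : ℕ) .{{_ : ℕ.NonZero L}} (s-periodic : ∀ i → s (i ℤ.+ + L) ≡ s i) where

  periodic-+ℕ* : ∀ a q → s (a ℤ.+ + q ℤ.* + L) ≡ s a
  periodic-+ℕ* a zero    = cong s (trans (cong (ℤ._+_ a) (ℤP.*-zeroˡ (+ L))) (ℤP.+-identityʳ a))
  periodic-+ℕ* a (suc q) = trans (cong s (ℓ a (+ q) (+ L))) (trans (s-periodic _) (periodic-+ℕ* a q))
    where
      ℓ : ∀ a q n → a ℤ.+ (+ 1 ℤ.+ q) ℤ.* n ≡ (a ℤ.+ q ℤ.* n) ℤ.+ n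
      ℓ = solve-∀

  periodic-+* : ∀ a q → s (a ℤ.+ q ℤ.* + L) ≡ s a
  periodic-+* a (+ q)    = periodic-+ℕ* a q
  periodic-+* a -[1+ q ] = sym (trans (cong s (ℓ a (+ suc q) (+ L))) (periodic-+ℕ* _ (suc q)))
    where
      ℓ : ∀ a q n → a ≡ (a ℤ.+ (ℤ.- q) ℤ.* n) ℤ.+ q ℤ.* n
      ℓ = solve-∀

  periodic-%ℕ : ∀ j m → s (+ (j ℤ.%ℕ L) ℤ.+ m) ≡ s (j ℤ.+ m)
  periodic-%ℕ j m = begin
    s (+ r ℤ.+ m)                               ≡⟨ cong s (ℓ (+ r) q (+ L) m) ⟩
    s (((+ r ℤ.+ q ℤ.* + L) ℤ.+ m) ℤ.+ (ℤ.- q) ℤ.* + L) ≡⟨ cong (λ j → s ((j ℤ.+ m) ℤ.+ (ℤ.- q) ℤ.* + L)) (a≡a%ℕn+[a/ℕn]*n j L) ⟨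
    s ((j ℤ.+ m) ℤ.+ (ℤ.- q) ℤ.* + L)           ≡⟨ periodic-+* (j ℤ.+ m) (ℤ.- q) ⟩
    s (j ℤ.+ m)                                 ∎
    where
      open ≡-Reasoning
      r = j ℤ.%ℕ L
      q = j ℤ./ℕ L
      ℓ : ∀ r q n m → r ℤ.+ m ≡ ((r ℤ.+ q ℤ.* n) ℤ.+ m) ℤ.+ (ℤ.- q) ℤ.* n
      ℓ = solve-∀

_++ᵂ_ : ∀ {R : A → A → Set} {x y z m n} → Walk R x y m → Walk R y z n → Walk R x z (m + n)
[]      ++ᵂ q = q
(r ∷ p) ++ᵂ q = r ∷ (p ++ᵂ q)

mapᵂ : ∀ {R S : A → A → Set} → (∀ {x y} → R x y → S x y) → ∀ {x y n} → Walk R x y n → Walk S x y n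
mapᵂ f []      = []
mapᵂ f (r ∷ p) = f r ∷ mapᵂ f p

module _ {A : Set} {R : A → A → Set} where

  Cycle3 : A → A → A → Set
  Cycle3 x y z = R x y × R y z × R z x

  module _ {x y z : A} (cyc : Cycle3 x y z) where
    private
      x→y : R x y
      x→y = proj₁ cyc
      y→z : R y z
      y→z = proj₁ (proj₂ cyc)
      z→x : R z x
      z→x = proj₂ (proj₂ cyc)

    cycle-closed : ∀ {v} → Among3 v x y z → Walk R v v 3
    cycle-closed (inj₁ refl)        = x→y ∷ (y→z ∷ (z→x ∷ []))
    cycle-closed (inj₂ (inj₁ refl)) = y→z ∷ (z→x ∷ (x→y ∷ []))
    cycle-closed (inj₂ (inj₂ refl)) = z→x ∷ (x→y ∷ (y→z ∷ []))

    cycle-reach : ∀ {u v} → Among3 u x y z → Among3 v x y z → ∃[ ℓ ] Walk R u v ℓ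
    cycle-reach u∈ v∈ = let (ℓ , p) = to-x u∈ ; (ℓ′ , q) = from-x v∈ in ℓ + ℓ′ , p ++ᵂ q
      where
        to-x : ∀ {u} → Among3 u x y z → ∃[ ℓ ] Walk R u x ℓ
        to-x (inj₁ refl)        = 0 , []
        to-x (inj₂ (inj₁ refl)) = 2 , y→z ∷ (z→x ∷ [])
        to-x (inj₂ (inj₂ refl)) = 1 , z→x ∷ []
        from-x : ∀ {v} → Among3 v x y z → ∃[ ℓ ] Walk R x v ℓ
        from-x (inj₁ refl)        = 0 , []
        from-x (inj₂ (inj₁ refl)) = 1 , x→y ∷ []
        from-x (inj₂ (inj₂ refl)) = 2 , x→y ∷ (y→z ∷ [])

  module _ (reach : ∀ u v → ∃[ ℓ ] Walk R u v ℓ) where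

    closed-walk-divisor-transfer : ∀ {d x} → (∀ ℓ → 0 < ℓ × Walk R x x ℓ → d ∣ ℓ) →
      ∀ {v ℓ} → Walk R v v ℓ → d ∣ ℓ
    closed-walk-divisor-transfer {d} {x} divides-closed {v} {ℓ} w =
      ∣m+n∣m⇒∣n (subst (d ∣_) (regroup s ℓ t) (∣closed (p ++ᵂ (w ++ᵂ q)))) (∣closed (p ++ᵂ q))
      where
        s t : ℕ
        s = proj₁ (reach x v)
        t = proj₁ (reach v x)
        p : Walk R x v s
        p = proj₂ (reach x v)
        q : Walk R v x t
        q = proj₂ (reach v x)
        ∣closed : ∀ {ℓ} → Walk R x x ℓ → d ∣ ℓ
        ∣closed {zero}  _ = d ∣0
        ∣closed {suc ℓ} w = divides-closed (suc ℓ) (ℕP.0<1+n , w)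
        regroup : ∀ s ℓ t → s + (ℓ + t) ≡ (s + t) + ℓ
        regroup s ℓ t = trans (cong (_+_ s) (ℕP.+-comm ℓ t)) (sym (ℕP.+-assoc s t ℓ))

module _ {n : ℕ} {R : Fin n → Fin n → Set} (R? : ∀ u v → Dec (R u v))
         (reach : ∀ u v → ∃[ ℓ ] Walk R u v ℓ) (m : ℕ) .{{_ : ℕ.NonZero m}} (root : Fin n) where

  -- Either every arc raises the depth from the root by 1 mod m, which makes every closed walk
  -- a multiple of m, or an offending arc closes up into a walk of length not divisible by m.
  private
    depth : Fin n → ℕ
    depth w = proj₁ (reach root w)

    Consistent : Fin n → Fin n → Set
    Consistent x y = (depth x + 1) % m ≡ depth y % m

    inconsistent-arc : ∀ {x y} → R x y → ¬ Consistent x y → ∃[ v ] ∃[ ℓ ] (Walk R v v ℓ × ¬ m ∣ ℓ)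
    inconsistent-arc {x} {y} x→y ¬consistent with m ∣? (depth x + suc t) | m ∣? (depth y + t)
      where t = proj₁ (reach y root)
    ... | no ∤ | _    = root , _ , proj₂ (reach root x) ++ᵂ (x→y ∷ proj₂ (reach y root)) , ∤
    ... | yes _ | no ∤ = root , _ , proj₂ (reach root y) ++ᵂ proj₂ (reach y root) , ∤
    ... | yes m∣₁ | yes m∣₂ = ⊥-elim (¬consistent (%-cancelʳ-+ t (depth x + 1) (depth y) m (begin
      (depth x + 1 + t) % m   ≡⟨ cong (_% m) (ℕP.+-assoc (depth x) 1 t) ⟩
      (depth x + suc t) % m   ≡⟨ n∣m⇒m%n≡0 _ m m∣₁ ⟩
      0                       ≡⟨ n∣m⇒m%n≡0 _ m m∣₂ ⟨
      (depth y + t) % m       ∎)))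
      where
        open ≡-Reasoning
        t = proj₁ (reach y root)

    consistent-walk : (∀ {x y} → R x y → Consistent x y) →
      ∀ {x w ℓ} → Walk R x w ℓ → (depth x + ℓ) % m ≡ depth w % m
    consistent-walk consistent {x} [] = cong (_% m) (ℕP.+-identityʳ (depth x))
    consistent-walk consistent {x} {w} (_∷_ {y = y} {n = ℓ} x→y p) = begin
      (depth x + suc ℓ) % m               ≡⟨ cong (_% m) (ℕP.+-assoc (depth x) 1 ℓ) ⟨
      (depth x + 1 + ℓ) % m               ≡⟨ %-distribˡ-+ (depth x + 1) ℓ m ⟩
      ((depth x + 1) % m + ℓ % m) % m     ≡⟨ cong (λ a → (a + ℓ % m) % m) (consistent x→y) ⟩
      (depth y % m + ℓ % m) % m           ≡⟨ %-distribˡ-+ (depth y) ℓ m ⟨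
      (depth y + ℓ) % m                   ≡⟨ consistent-walk consistent p ⟩
      depth w % m                         ∎
      where open ≡-Reasoning

  closed-walk-lengths-mod : (∃[ v ] ∃[ ℓ ] (Walk R v v ℓ × ¬ m ∣ ℓ)) ⊎ (∀ {v ℓ} → Walk R v v ℓ → m ∣ ℓ)
  closed-walk-lengths-mod with FP.any? (λ x → FP.any? (λ y → R? x y ×-dec ¬? ((depth x + 1) % m ℕ.≟ depth y % m)))
  ... | yes (x , y , x→y , ¬consistent) = inj₁ (inconsistent-arc x→y ¬consistent)
  ... | no none = inj₂ λ {v} {ℓ} w → m%n≡0⇒n∣m ℓ m (trans
        (%-cancelˡ-+ (depth v) ℓ 0 m (trans (consistent-walk consistent w) (cong (_% m) (sym (ℕP.+-identityʳ (depth v))))))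
        (m*n%n≡0 0 m))
    where
      consistent : ∀ {x y} → R x y → Consistent x y
      consistent {x} {y} x→y with (depth x + 1) % m ℕ.≟ depth y % m
      ... | yes c = c
      ... | no ¬c = ⊥-elim (none (x , y , x→y , ¬c))

module _ (T : Triangulation) where
  open Triangulation T

  record Triangle (f : Face) (a b x : V) : Set where
    constructor triangle
    field
      a∈f : a ∈F f
      b∈f : b ∈F f
      x∈f : x ∈F f
      a≢b : a ≢ b
      x≢a : x ≢ a
      x≢b : x ≢ b

  Triangle-flip : ∀ {f a b x} → Triangle f a b x → Triangle f b a x
  Triangle-flip (triangle a∈ b∈ x∈ a≢b x≢a x≢b) = triangle b∈ a∈ x∈ (≢-sym a≢b) x≢b x≢a

  Triangle-rotate : ∀ {f a b x} → Triangle f a b x → Triangle f b x a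
  Triangle-rotate (triangle a∈ b∈ x∈ a≢b x≢a x≢b) = triangle b∈ x∈ a∈ (≢-sym x≢b) a≢b (≢-sym x≢a)

  Triangle-subst : ∀ {f a b x a′ b′ x′} → a ≡ a′ → b ≡ b′ → x ≡ x′ →
    Triangle f a b x → Triangle f a′ b′ x′
  Triangle-subst refl refl refl t = t

  third-vertex : ∀ f {a b} → a ∈F f → b ∈F f → a ≢ b → ∃[ x ] Triangle f a b x
  third-vertex f = complete
    where
      fa≢fb : fa f ≢ fb f
      fa≢fb = proj₁ (face-distinct f)
      fb≢fc : fb f ≢ fc f
      fb≢fc = proj₁ (proj₂ (face-distinct f))
      fa≢fc : fa f ≢ fc f
      fa≢fc = proj₂ (proj₂ (face-distinct f))
      fa∈ : fa f ∈F f
      fa∈ = inj₁ refl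
      fb∈ : fb f ∈F f
      fb∈ = inj₂ (inj₁ refl)
      fc∈ : fc f ∈F f
      fc∈ = inj₂ (inj₂ refl)
      complete : ∀ {a b} → a ∈F f → b ∈F f → a ≢ b → ∃[ x ] Triangle f a b x
      complete (inj₁ refl)        (inj₁ refl)        a≢b = ⊥-elim (a≢b refl)
      complete (inj₂ (inj₁ refl)) (inj₂ (inj₁ refl)) a≢b = ⊥-elim (a≢b refl)
      complete (inj₂ (inj₂ refl)) (inj₂ (inj₂ refl)) a≢b = ⊥-elim (a≢b refl)
      complete (inj₁ refl)        (inj₂ (inj₁ refl)) a≢b = fc f , triangle fa∈ fb∈ fc∈ a≢b (≢-sym fa≢fc) (≢-sym fb≢fc)
      complete (inj₂ (inj₁ refl)) (inj₁ refl)        a≢b = fc f , triangle fb∈ fa∈ fc∈ a≢b (≢-sym fb≢fc) (≢-sym fa≢fc)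
      complete (inj₁ refl)        (inj₂ (inj₂ refl)) a≢b = fb f , triangle fa∈ fc∈ fb∈ a≢b (≢-sym fa≢fb) fb≢fc
      complete (inj₂ (inj₂ refl)) (inj₁ refl)        a≢b = fb f , triangle fc∈ fa∈ fb∈ a≢b fb≢fc (≢-sym fa≢fb)
      complete (inj₂ (inj₁ refl)) (inj₂ (inj₂ refl)) a≢b = fa f , triangle fb∈ fc∈ fa∈ a≢b fa≢fb fa≢fc
      complete (inj₂ (inj₂ refl)) (inj₂ (inj₁ refl)) a≢b = fa f , triangle fc∈ fb∈ fa∈ a≢b fa≢fc fa≢fb

  Triangle-apex-unique : ∀ {f a b x y} → Triangle f a b x → Triangle f a b y → x ≡ y
  Triangle-apex-unique (triangle a∈ b∈ x∈ a≢b x≢a x≢b) (triangle _ _ y∈ _ y≢a y≢b) =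
    among3-third-unique a∈ b∈ a≢b x∈ x≢a x≢b y∈ y≢a y≢b

  Triangle-among3 : ∀ {f a b x v} → Triangle f a b x → v ∈F f → Among3 v a b x
  Triangle-among3 {a = a} {b} {v = v} t@(triangle a∈ b∈ _ a≢b _ _) v∈ with v ≟ a | v ≟ b
  ... | yes v≡a | _ = inj₁ v≡a
  ... | no _ | yes v≡b = inj₂ (inj₁ v≡b)
  ... | no v≢a | no v≢b = inj₂ (inj₂ (Triangle-apex-unique (triangle a∈ b∈ v∈ a≢b v≢a v≢b) t))

  faces-on-edge : ∀ {a b f g h} → a ≢ b → f ≢ g → a ∈F f → b ∈F f → a ∈F g → b ∈F g →
    a ∈F h → b ∈F h → h ≡ f ⊎ h ≡ g
  faces-on-edge {a} {b} {f} {g} {h} a≢b f≢g a∈f b∈f a∈g b∈g a∈h b∈h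
    with edge-two-faces a b (a≢b , f , a∈f , b∈f)
  ... | f₀ , g₀ , _ , _ , _ , only with only f (a∈f , b∈f) | only g (a∈g , b∈g) | only h (a∈h , b∈h)
  ... | inj₁ p | inj₁ q | _      = ⊥-elim (f≢g (trans p (sym q)))
  ... | inj₂ p | inj₂ q | _      = ⊥-elim (f≢g (trans p (sym q)))
  ... | inj₁ p | inj₂ _ | inj₁ r = inj₁ (trans r (sym p))
  ... | inj₁ _ | inj₂ q | inj₂ r = inj₂ (trans r (sym q))
  ... | inj₂ _ | inj₁ q | inj₁ r = inj₂ (trans r (sym q))
  ... | inj₂ p | inj₁ _ | inj₂ r = inj₁ (trans r (sym p))

  opposite-triangle : ∀ {f a b x} → Triangle f a b x → ∃[ g ] (f ≢ g × ∃[ y ] Triangle g a b y)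
  opposite-triangle {f} {a} {b} (triangle a∈f b∈f _ a≢b _ _) with edge-two-faces a b (a≢b , f , a∈f , b∈f)
  ... | f₀ , g₀ , f₀≢g₀ , (a∈f₀ , b∈f₀) , (a∈g₀ , b∈g₀) , only with only f (a∈f , b∈f)
  ... | inj₁ refl = g₀ , f₀≢g₀ , third-vertex g₀ a∈g₀ b∈g₀ a≢b
  ... | inj₂ refl = f₀ , ≢-sym f₀≢g₀ , third-vertex f₀ a∈f₀ b∈f₀ a≢b

  opposite-apex : ∀ {f g h a b x y z} → f ≢ g → Triangle f a b x → Triangle g a b y → Triangle h a b z →
    z ≢ x → z ≡ y
  opposite-apex f≢g tf@(triangle a∈f b∈f _ a≢b _ _) tg@(triangle a∈g b∈g _ _ _ _) th@(triangle a∈h b∈h _ _ _ _) z≢x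
    with faces-on-edge a≢b f≢g a∈f b∈f a∈g b∈g a∈h b∈h
  ... | inj₁ refl = ⊥-elim (z≢x (Triangle-apex-unique th tf))
  ... | inj₂ refl = Triangle-apex-unique th tg

  module _ {f g a b x} (f≢g : f ≢ g) (tf : Triangle f a b x) (tg : Triangle g a b x) where

    private
      ∈f : ∀ {w} → Among3 w a b x → w ∈F f
      ∈f (inj₁ refl)        = Triangle.a∈f tf
      ∈f (inj₂ (inj₁ refl)) = Triangle.b∈f tf
      ∈f (inj₂ (inj₂ refl)) = Triangle.x∈f tf

      ∈g : ∀ {w} → Among3 w a b x → w ∈F g
      ∈g (inj₁ refl)        = Triangle.a∈f tg
      ∈g (inj₂ (inj₁ refl)) = Triangle.b∈f tg
      ∈g (inj₂ (inj₂ refl)) = Triangle.x∈f tg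

      among3-on : ∀ {w h} → h ≡ f ⊎ h ≡ g → w ∈F h → Among3 w a b x
      among3-on (inj₁ refl) = Triangle-among3 tf
      among3-on (inj₂ refl) = Triangle-among3 tg

      around : ∀ {t h h′} → Among3 t a b x → h ≡ f ⊎ h ≡ g → Star (LinkStep t) h h′ → h′ ≡ f ⊎ h′ ≡ g
      around t∈ h∈ ε = h∈
      around t∈ h∈ ((_ , t∈h′ , w , w≢t , w∈h , w∈h′) ◅ steps) =
        around t∈ (faces-on-edge (≢-sym w≢t) f≢g (∈f t∈) (∈f w∈) (∈g t∈) (∈g w∈) t∈h′ w∈h′) steps
        where
          w∈ : Among3 w a b x
          w∈ = among3-on h∈ w∈h

      along : ∀ {v w} → Among3 v a b x → Star Adj v w → Among3 w a b x
      along v∈ ε = v∈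
      along v∈ ((_ , h , v∈h , w∈h) ◅ path) =
        along (among3-on (around v∈ (inj₁ refl) (link-connected _ f _ (∈f v∈) v∈h)) w∈h) path

    coincident-apexes⇒among3 : ∀ v → Among3 v a b x
    coincident-apexes⇒among3 v = along (inj₁ refl) (connected a v)

  -- Fails only for the sphere made of two triangles, whose three vertices cannot carry a zigzag.
  NonDegenerate : Set
  NonDegenerate = ∀ {f g a b x y} → f ≢ g → Triangle f a b x → Triangle g a b y → x ≢ y

  LocalZigzagAt : (ℤ → V) → ℤ → Set
  LocalZigzagAt s i = ∃[ f ] ∃[ g ] (f ≢ g
    × Triangle f (s (i ℤ.+ + 1)) (s (i ℤ.+ + 2)) (s i)
    × Triangle g (s (i ℤ.+ + 1)) (s (i ℤ.+ + 2)) (s (i ℤ.+ + 3))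
    × s i ≢ s (i ℤ.+ + 3))

  LocalZigzag : (ℤ → V) → Set
  LocalZigzag s = ∀ i → LocalZigzagAt s i

  isZigzag⇒local : ∀ {n z} → IsZigzag T n z → LocalZigzag z
  isZigzag⇒local {z = z} Z i with IsZigzag.faces Z i | IsZigzag.disjoint Z i
  ... | f , g , (z₀∈f , z₁∈f , z₂∈f) , (z₁∈g , z₂∈g , z₃∈g) , (f≢g , _) | z₀≢z₂ , z₀≢z₃ , z₁≢z₂ , z₁≢z₃ =
    f , g , f≢g , (triangle z₁∈f z₂∈f z₀∈f z₁≢z₂ z₀≢z₁ z₀≢z₂)
                , (triangle z₁∈g z₂∈g z₃∈g z₁≢z₂ (≢-sym z₁≢z₃) (≢-sym z₂≢z₃)) , z₀≢z₃
    where
      z₀≢z₁ : z i ≢ z (i ℤ.+ + 1)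
      z₀≢z₁ = proj₁ (IsZigzag.edges Z i)
      z₂≢z₃ : z (i ℤ.+ + 2) ≢ z (i ℤ.+ + 3)
      z₂≢z₃ = subst (λ k → z (i ℤ.+ + 2) ≢ z k) (ℤP.+-assoc i (+ 2) (+ 1)) (proj₁ (IsZigzag.edges Z (i ℤ.+ + 2)))

  local⇒nonDegenerate : ∀ {s} → LocalZigzag s → NonDegenerate
  local⇒nonDegenerate {s} Ls f≢g tf tg refl with Ls (+ 0)
  ... | _ , _ , _ , triangle _ _ _ s₁≢s₂ s₀≢s₁ s₀≢s₂ , triangle _ _ _ _ s₃≢s₁ s₃≢s₂ , s₀≢s₃ =
    among3-no-four (among3 _) (among3 _) (among3 _) (among3 _) s₀≢s₁ s₀≢s₂ s₀≢s₃ s₁≢s₂ (≢-sym s₃≢s₁) (≢-sym s₃≢s₂)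
    where
      among3 : ∀ v → Among3 v _ _ _
      among3 = coincident-apexes⇒among3 f≢g tf tg

  reverse-local : ∀ {s} → LocalZigzag s → LocalZigzag (reverseSeq T s)
  reverse-local {s} Ls i with Ls (ℤ.- i ℤ.+ -[1+ 2 ])
  ... | f , g , f≢g , tf , tg , s₀≢s₃ =
    g , f , ≢-sym f≢g ,
    Triangle-subst (at-2 i) (at-1 i) (at-3 i) (Triangle-flip tg) ,
    Triangle-subst (at-2 i) (at-1 i) (at-0 i) (Triangle-flip tf) ,
    λ e → s₀≢s₃ (trans (at-0 i) (trans (sym e) (sym (at-3 i))))
    where
      at-0 : ∀ i → s (ℤ.- i ℤ.+ -[1+ 2 ]) ≡ s (ℤ.- (i ℤ.+ + 3))
      at-0 i = cong s (ℓ i)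
        where
          ℓ : ∀ i → ℤ.- i ℤ.+ -[1+ 2 ] ≡ ℤ.- (i ℤ.+ + 3)
          ℓ = solve-∀
      at-1 : ∀ i → s ((ℤ.- i ℤ.+ -[1+ 2 ]) ℤ.+ + 1) ≡ s (ℤ.- (i ℤ.+ + 2))
      at-1 i = cong s (ℓ i)
        where
          ℓ : ∀ i → (ℤ.- i ℤ.+ -[1+ 2 ]) ℤ.+ + 1 ≡ ℤ.- (i ℤ.+ + 2)
          ℓ = solve-∀
      at-2 : ∀ i → s ((ℤ.- i ℤ.+ -[1+ 2 ]) ℤ.+ + 2) ≡ s (ℤ.- (i ℤ.+ + 1))
      at-2 i = cong s (ℓ i)
        where
          ℓ : ∀ i → (ℤ.- i ℤ.+ -[1+ 2 ]) ℤ.+ + 2 ≡ ℤ.- (i ℤ.+ + 1)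
          ℓ = solve-∀
      at-3 : ∀ i → s ((ℤ.- i ℤ.+ -[1+ 2 ]) ℤ.+ + 3) ≡ s (ℤ.- i)
      at-3 i = cong s (ℓ i)
        where
          ℓ : ∀ i → (ℤ.- i ℤ.+ -[1+ 2 ]) ℤ.+ + 3 ≡ ℤ.- i
          ℓ = solve-∀

  module _ {s t : ℤ → V} (Ls : LocalZigzag s) (Lt : LocalZigzag t) where

    local-step-forward : ∀ p q → s p ≡ t q → s (p ℤ.+ + 1) ≡ t (q ℤ.+ + 1) → s (p ℤ.+ + 2) ≡ t (q ℤ.+ + 2) →
      s (p ℤ.+ + 3) ≡ t (q ℤ.+ + 3)
    local-step-forward p q e₀ e₁ e₂ with Ls p | Lt q
    ... | _ , _ , f≢g , tf , tg , _ | _ , _ , _ , _ , th , t₀≢t₃ =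
      sym (opposite-apex f≢g tf tg (Triangle-subst (sym e₁) (sym e₂) refl th) λ e → t₀≢t₃ (trans (sym e₀) (sym e)))

    local-step-backward : ∀ p q → s (p ℤ.+ + 1) ≡ t (q ℤ.+ + 1) → s (p ℤ.+ + 2) ≡ t (q ℤ.+ + 2) →
      s (p ℤ.+ + 3) ≡ t (q ℤ.+ + 3) → s p ≡ t q
    local-step-backward p q e₁ e₂ e₃ with Ls p | Lt q
    ... | _ , _ , f≢g , tf , tg , _ | _ , _ , _ , th , _ , t₀≢t₃ =
      sym (opposite-apex (≢-sym f≢g) tg tf (Triangle-subst (sym e₁) (sym e₂) refl th) λ e → t₀≢t₃ (trans e e₃))

    module _ (i j : ℤ) where

      private
        Agree : ℤ → Set
        Agree m = s (i ℤ.+ m) ≡ t (j ℤ.+ m)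

        Agree3 : ℤ → Set
        Agree3 m = Agree m × Agree (m ℤ.+ + 1) × Agree (m ℤ.+ + 2)

        reindex : ∀ {m m′} → m ≡ m′ → Agree m → Agree m′
        reindex = subst Agree

        unshift : ∀ m k → Agree (m ℤ.+ k) → s ((i ℤ.+ m) ℤ.+ k) ≡ t ((j ℤ.+ m) ℤ.+ k)
        unshift m k = subst₂ (λ a b → s a ≡ t b) (sym (ℤP.+-assoc i m k)) (sym (ℤP.+-assoc j m k))

        shift : ∀ m k → s ((i ℤ.+ m) ℤ.+ k) ≡ t ((j ℤ.+ m) ℤ.+ k) → Agree (m ℤ.+ k)
        shift m k = subst₂ (λ a b → s a ≡ t b) (ℤP.+-assoc i m k) (ℤP.+-assoc j m k)

        forward : ∀ m → Agree3 m → Agree3 (ℤ.suc m)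
        forward m (a₀ , a₁ , a₂) =
          reindex (ℓ₁ m) a₁ , reindex (ℓ₂ m) a₂ ,
          reindex (ℓ₃ m) (shift m (+ 3) (local-step-forward (i ℤ.+ m) (j ℤ.+ m)
            a₀ (unshift m (+ 1) a₁) (unshift m (+ 2) a₂)))
          where
            ℓ₁ : ∀ m → m ℤ.+ + 1 ≡ + 1 ℤ.+ m
            ℓ₁ = solve-∀
            ℓ₂ : ∀ m → m ℤ.+ + 2 ≡ (+ 1 ℤ.+ m) ℤ.+ + 1
            ℓ₂ = solve-∀
            ℓ₃ : ∀ m → m ℤ.+ + 3 ≡ (+ 1 ℤ.+ m) ℤ.+ + 2
            ℓ₃ = solve-∀

        backward : ∀ m → Agree3 m → Agree3 (ℤ.pred m)
        backward m (a₀ , a₁ , a₂) =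
          local-step-backward (i ℤ.+ m′) (j ℤ.+ m′) (unshift m′ (+ 1) a₀′) (unshift m′ (+ 2) a₁′) (unshift m′ (+ 3) a₂′) ,
          a₀′ , a₁′
          where
            m′ : ℤ
            m′ = -[1+ 0 ] ℤ.+ m
            ℓ₀ : ∀ m → m ≡ (-[1+ 0 ] ℤ.+ m) ℤ.+ + 1
            ℓ₀ = solve-∀
            ℓ₁ : ∀ m → m ℤ.+ + 1 ≡ (-[1+ 0 ] ℤ.+ m) ℤ.+ + 2
            ℓ₁ = solve-∀
            ℓ₂ : ∀ m → m ℤ.+ + 2 ≡ (-[1+ 0 ] ℤ.+ m) ℤ.+ + 3
            ℓ₂ = solve-∀
            a₀′ : Agree (m′ ℤ.+ + 1)
            a₀′ = reindex (ℓ₀ m) a₀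
            a₁′ : Agree (m′ ℤ.+ + 2)
            a₁′ = reindex (ℓ₁ m) a₁
            a₂′ : Agree (m′ ℤ.+ + 3)
            a₂′ = reindex (ℓ₂ m) a₂

      local-determined : s i ≡ t j → s (i ℤ.+ + 1) ≡ t (j ℤ.+ + 1) → s (i ℤ.+ + 2) ≡ t (j ℤ.+ + 2) →
        ∀ m → s (i ℤ.+ m) ≡ t (j ℤ.+ m)
      local-determined e₀ e₁ e₂ m = proj₁ (ℤ-induction Agree3 start forward backward m)
        where
          start : Agree3 (+ 0)
          start = subst₂ (λ a b → s a ≡ t b) (sym (ℤP.+-identityʳ i)) (sym (ℤP.+-identityʳ j)) e₀ , e₁ , e₂

  local⇒isZigzag : ∀ {n s} → LocalZigzag s → 0 < n → (∀ i → s (i ℤ.+ + n) ≡ s i) →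
    (∀ p → 0 < p → p < n → ¬ (∀ i → s (i ℤ.+ + p) ≡ s i)) → IsZigzag T n s
  local⇒isZigzag {n} {s} Ls n>0 periodic minimal = record
    { len-pos  = n>0
    ; periodic = periodic
    ; minimal  = minimal
    ; edges    = λ i → edge (Ls i)
    ; adjacent = λ i → adjacent (Ls i)
    ; faces    = λ i → faces (Ls i)
    ; disjoint = λ i → disjoint (Ls i)
    }
    where
      module _ {i : ℤ} where
        s₀ s₁ s₂ s₃ : V
        s₀ = s i
        s₁ = s (i ℤ.+ + 1)
        s₂ = s (i ℤ.+ + 2)
        s₃ = s (i ℤ.+ + 3)

        edge : LocalZigzagAt s i → Adj s₀ s₁
        edge (f , _ , _ , (triangle s₁∈f _ s₀∈f _ s₀≢s₁ _) , _) = s₀≢s₁ , f , s₀∈f , s₁∈f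

        adjacent : LocalZigzagAt s i → EdgesAdj T s₀ s₁ s₁ s₂
        adjacent (f , _ , _ , (triangle s₁∈f s₂∈f s₀∈f _ s₀≢s₁ s₀≢s₂) , _) = different , f , s₀∈f , s₁∈f , s₁∈f , s₂∈f
          where
            different : ¬ SameEdge T s₀ s₁ s₁ s₂
            different (inj₁ (e , _)) = s₀≢s₁ e
            different (inj₂ (e , _)) = s₀≢s₂ e

        faces : LocalZigzagAt s i →
          ∃[ f ] ∃[ g ] ((s₀ ∈F f × s₁ ∈F f × s₂ ∈F f) × (s₁ ∈F g × s₂ ∈F g × s₃ ∈F g) × FacesAdj T f g)
        faces (f , g , f≢g , triangle s₁∈f s₂∈f s₀∈f s₁≢s₂ _ _ , triangle s₁∈g s₂∈g s₃∈g _ _ _ , _) =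
          f , g , (s₀∈f , s₁∈f , s₂∈f) , (s₁∈g , s₂∈g , s₃∈g) , f≢g , s₁ , s₂ , s₁≢s₂ , s₁∈f , s₂∈f , s₁∈g , s₂∈g

        disjoint : LocalZigzagAt s i → EdgesDisjoint T s₀ s₁ s₂ s₃
        disjoint (_ , _ , _ , triangle _ _ _ s₁≢s₂ _ s₀≢s₂ , triangle _ _ _ _ s₃≢s₁ _ , s₀≢s₃) =
          s₀≢s₂ , s₀≢s₃ , s₁≢s₂ , ≢-sym s₃≢s₁

module _ (T : Triangulation) where
  open Triangulation T

  -- Candidates for three consecutive vertices of a zigzag; advance drops c₀ and appends
  -- the apex of the other face on the edge c₁c₂.
  record Corner : Set where
    constructor corner
    field
      c₀ c₁ c₂ : V
      face     : Face
      on-face  : Triangle T face c₁ c₂ c₀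

  open Corner public

  record _≈ᶜ_ (c c′ : Corner) : Set where
    constructor mk≈ᶜ
    field
      ≡₀ : c₀ c ≡ c₀ c′
      ≡₁ : c₁ c ≡ c₁ c′
      ≡₂ : c₂ c ≡ c₂ c′

  ≈ᶜ-sym : ∀ {c c′} → c ≈ᶜ c′ → c′ ≈ᶜ c
  ≈ᶜ-sym (mk≈ᶜ e₀ e₁ e₂) = mk≈ᶜ (sym e₀) (sym e₁) (sym e₂)

  _≈ᶜ?_ : ∀ c c′ → Dec (c ≈ᶜ c′)
  c ≈ᶜ? c′ = map′ (λ (e₀ , e₁ , e₂) → mk≈ᶜ e₀ e₁ e₂) (λ (mk≈ᶜ e₀ e₁ e₂) → e₀ , e₁ , e₂)
    ((c₀ c ≟ c₀ c′) ×-dec (c₁ c ≟ c₁ c′) ×-dec (c₂ c ≟ c₂ c′))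

  private
    opposite : (c : Corner) → ∃[ g ] (face c ≢ g × ∃[ n ] Triangle T g (c₁ c) (c₂ c) n)
    opposite c = opposite-triangle T (on-face c)

  opposite-face : Corner → Face
  opposite-face c = proj₁ (opposite c)

  apex : Corner → V
  apex c = proj₁ (proj₂ (proj₂ (opposite c)))

  face≢opposite-face : ∀ c → face c ≢ opposite-face c
  face≢opposite-face c = proj₁ (proj₂ (opposite c))

  opposite-on-face : ∀ c → Triangle T (opposite-face c) (c₁ c) (c₂ c) (apex c)
  opposite-on-face c = proj₂ (proj₂ (proj₂ (opposite c)))

  advance : Corner → Corner
  advance c = corner (c₁ c) (c₂ c) (apex c) (opposite-face c) (Triangle-rotate T (opposite-on-face c))

  advance^ : ℕ → Corner → Corner
  advance^ zero    c = c
  advance^ (suc k) c = advance (advance^ k c)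

  advance^-+ : ∀ k m c → advance^ (k + m) c ≡ advance^ k (advance^ m c)
  advance^-+ zero    m c = refl
  advance^-+ (suc k) m c = cong advance (advance^-+ k m c)

  module _ (nd : NonDegenerate T) where

    apex-cong : ∀ {c c′} → c ≈ᶜ c′ → apex c ≡ apex c′
    apex-cong {corner _ _ _ f tf} {corner _ _ _ f′ tf′} (mk≈ᶜ refl refl refl)
      with opposite-triangle T tf | opposite-triangle T tf′
    ... | g , f≢g , n , tg | g′ , f′≢g′ , n′ , tg′ =
      sym (opposite-apex T f≢g tf tg tg′ (≢-sym (nd f′≢g′ tf′ tg′)))

    advance-cong : ∀ {c c′} → c ≈ᶜ c′ → advance c ≈ᶜ advance c′
    advance-cong e@(mk≈ᶜ _ e₁ e₂) = mk≈ᶜ e₁ e₂ (apex-cong e)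

    advance-injective : ∀ {c c′} → advance c ≈ᶜ advance c′ → c ≈ᶜ c′
    advance-injective {corner _ _ _ f tf} {corner _ _ _ f′ tf′} (mk≈ᶜ refl refl n≡n′)
      with opposite-triangle T tf | opposite-triangle T tf′
    ... | g , f≢g , n , tg | g′ , f′≢g′ , n′ , tg′ =
      mk≈ᶜ (sym (opposite-apex T (≢-sym f≢g) tg tf tf′ λ x′≡n → nd f′≢g′ tf′ tg′ (trans x′≡n n≡n′))) refl refl

    advance^-cong : ∀ k {c c′} → c ≈ᶜ c′ → advance^ k c ≈ᶜ advance^ k c′
    advance^-cong zero    e = e
    advance^-cong (suc k) e = advance-cong (advance^-cong k e)

    advance^-cancel : ∀ k m c → advance^ k c ≈ᶜ advance^ (k + m) c → c ≈ᶜ advance^ m c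
    advance^-cancel zero    m c e = e
    advance^-cancel (suc k) m c e = advance^-cancel k m c (advance-injective e)

    private
      encode : Corner → Fin (nV ℕ.* (nV ℕ.* nV))
      encode c = F.combine (c₀ c) (F.combine (c₁ c) (c₂ c))

      encode-injective : ∀ c c′ → encode c ≡ encode c′ → c ≈ᶜ c′
      encode-injective c c′ e with FP.combine-injective (c₀ c) _ (c₀ c′) _ e
      ... | e₀ , e′ with FP.combine-injective (c₁ c) _ (c₁ c′) _ e′
      ... | e₁ , e₂ = mk≈ᶜ e₀ e₁ e₂

    corner-recurrent : ∀ c → ∃[ P ] (0 < P × c ≈ᶜ advance^ P c)
    corner-recurrent c with FP.pigeonhole (ℕP.n<1+n _) (λ k → encode (advance^ (toℕ k) c))
    ... | i , j , i<j , e = toℕ j ℕ.∸ toℕ i , ℕP.m<n⇒0<n∸m i<j ,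
      advance^-cancel (toℕ i) (toℕ j ℕ.∸ toℕ i) c
        (subst (λ k → advance^ (toℕ i) c ≈ᶜ advance^ k c) (sym (ℕP.m+[n∸m]≡n (ℕP.<⇒≤ i<j)))
          (encode-injective _ _ e))

    private
      Returns : Corner → ℕ → Set
      Returns c m = 0 < m × c ≈ᶜ advance^ m c

      -- The least return time of c is the length of its zigzag, read off the orbit modulo it.
      module Orbit (c : Corner) (n : ℕ) (returns : c ≈ᶜ advance^ (suc n) c)
                   (first-return : ∀ m → m < suc n → ¬ Returns c m) where

        F : ℕ → V
        F k = c₀ (advance^ k c)

        F-periodic : ∀ k → F (k + suc n) ≡ F k
        F-periodic k = trans (cong c₀ (advance^-+ k (suc n) c)) (_≈ᶜ_.≡₀ (advance^-cong k (≈ᶜ-sym returns)))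

        z : ℤ → V
        z = periodicℤ F (suc n) F-periodic

        z-+ : ∀ i k → z (i ℤ.+ + k) ≡ F (k + i ℤ.%ℕ suc n)
        z-+ i k = trans (periodicℤ-+ F (suc n) F-periodic i k) (cong F (ℕP.+-comm (i ℤ.%ℕ suc n) k))

        z-ℕ : ∀ k → z (+ k) ≡ F k
        z-ℕ k = trans (z-+ (+ 0) k) (cong F (ℕP.+-identityʳ k))

        z-local : LocalZigzag T z
        z-local i =
          face st , opposite-face st , face≢opposite-face st ,
          Triangle-subst T (sym (z-+ i 1)) (sym (z-+ i 2)) refl (on-face st) ,
          Triangle-subst T (sym (z-+ i 1)) (sym (z-+ i 2)) (sym (z-+ i 3)) (opposite-on-face st) ,
          λ e → nd (face≢opposite-face st) (on-face st) (opposite-on-face st) (trans e (z-+ i 3))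
          where st = advance^ (i ℤ.%ℕ suc n) c

        z-minimal : ∀ p → 0 < p → p < suc n → ¬ (∀ i → z (i ℤ.+ + p) ≡ z i)
        z-minimal p p>0 p<N shift =
          first-return p p<N (p>0 , mk≈ᶜ (at 0) (at 1) (at 2))
          where
            at : ∀ k → F k ≡ F (k + p)
            at k = sym (trans (sym (z-ℕ (k + p))) (trans (shift (+ k)) (z-ℕ k)))

        zigzag : Zigzag T
        zigzag = record
          { len      = suc n
          ; seq      = z
          ; isZigzag = local⇒isZigzag T z-local ℕP.0<1+n
                         (λ i → trans (z-+ i (suc n)) (trans (cong F (ℕP.+-comm (suc n) _)) (F-periodic (i ℤ.%ℕ suc n))))
                         z-minimal
          }

    corner-on-zigzag : (c : Corner) →
      ∃[ Z ] (Zigzag.seq Z (+ 0) ≡ c₀ c × Zigzag.seq Z (+ 1) ≡ c₁ c × Zigzag.seq Z (+ 2) ≡ c₂ c)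
    corner-on-zigzag c with least-witness (λ m → (0 ℕ.<? m) ×-dec (c ≈ᶜ? advance^ m c)) (proj₂ (corner-recurrent c))
    ... | suc n , (_ , returns) , first =
      zigzag , z-ℕ 0 , z-ℕ 1 , z-ℕ 2
      where open Orbit c n returns first

module _ (T : Triangulation) where
  open Triangulation T

  Visits : (ℤ → V) → ℤ → V → V → V → Set
  Visits s j x y w = s j ≡ x × s (j ℤ.+ + 1) ≡ y × s (j ℤ.+ + 2) ≡ w

  Visits? : ∀ s j x y w → Dec (Visits s j x y w)
  Visits? s j x y w = (s j ≟ x) ×-dec (s (j ℤ.+ + 1) ≟ y) ×-dec (s (j ℤ.+ + 2) ≟ w)

  Visits-transport : ∀ {s t : ℤ → V} {i j x y w} → (∀ m → s (i ℤ.+ m) ≡ t (j ℤ.+ m)) →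
    Visits t j x y w → Visits s i x y w
  Visits-transport {s} {t} {i} {j} agree (e₀ , e₁ , e₂) =
    trans (cong s (sym (ℤP.+-identityʳ i))) (trans (agree (+ 0)) (trans (cong t (ℤP.+-identityʳ j)) e₀)) ,
    trans (agree (+ 1)) e₁ , trans (agree (+ 2)) e₂

  agreement⇒SameCyclic : ∀ {s t : ℤ → V} a b → (∀ m → s (a ℤ.+ m) ≡ t (b ℤ.+ m)) → SameCyclic T s t
  agreement⇒SameCyclic {s} {t} a b agree = a ℤ.- b , λ i →
    trans (cong t (ℓ₁ b i)) (trans (sym (agree (i ℤ.- b))) (cong s (ℓ₂ a b i)))
    where
      ℓ₁ : ∀ b i → i ≡ b ℤ.+ (i ℤ.- b)
      ℓ₁ = solve-∀
      ℓ₂ : ∀ a b i → a ℤ.+ (i ℤ.- b) ≡ i ℤ.+ (a ℤ.- b)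
      ℓ₂ = solve-∀

  module _ (Z : Zigzag T) where
    open Zigzag Z
    open IsZigzag isZigzag

    zigzag-index-mod : ∀ j → ∃[ i ] (i < len × ∀ m → seq (+ i ℤ.+ m) ≡ seq (j ℤ.+ m))
    zigzag-index-mod j = j ℤ.%ℕ len , n%ℕd<d j len , periodic-%ℕ seq len periodic j
      where instance _ = ℕ.>-nonZero len-pos

    Visits-mod : ∀ {j x y w} → Visits seq j x y w → ∃[ i ] (i < len × Visits seq (+ i) x y w)
    Visits-mod {j} vis with zigzag-index-mod j
    ... | i , i<len , agree = i , i<len , Visits-transport {s = seq} {t = seq} agree vis

    zigzag-no-shorter-shift : ∀ {i j} → i < j → j < len → ¬ (∀ m → seq (+ i ℤ.+ m) ≡ seq (+ j ℤ.+ m))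
    zigzag-no-shorter-shift {i} {j} i<j j<len agree =
      minimal (j ℕ.∸ i) (ℕP.m<n⇒0<n∸m i<j) (ℕP.≤-<-trans (ℕP.m∸n≤m j i) j<len) λ a →
        trans (cong seq (ℓ a)) (sym (trans (cong seq (ℓ₀ (+ i) a)) (agree (a ℤ.- + i))))
      where
        j≡i+[j∸i] : + j ≡ + i ℤ.+ + (j ℕ.∸ i)
        j≡i+[j∸i] = cong +_ (sym (ℕP.m+[n∸m]≡n (ℕP.<⇒≤ i<j)))
        ℓ₀ : ∀ i a → a ≡ i ℤ.+ (a ℤ.- i)
        ℓ₀ = solve-∀
        ℓ : ∀ a → a ℤ.+ + (j ℕ.∸ i) ≡ + j ℤ.+ (a ℤ.- + i)
        ℓ a = trans (ℓ′ (+ i) (+ (j ℕ.∸ i)) a) (cong (λ J → J ℤ.+ (a ℤ.- + i)) (sym j≡i+[j∸i]))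
          where
            ℓ′ : ∀ i p a → a ℤ.+ p ≡ (i ℤ.+ p) ℤ.+ (a ℤ.- i)
            ℓ′ = solve-∀

  Visits-determined : ∀ {s t : ℤ → V} {i j x y w} → LocalZigzag T s → LocalZigzag T t →
    Visits s i x y w → Visits t j x y w → ∀ m → s (i ℤ.+ m) ≡ t (j ℤ.+ m)
  Visits-determined {i = i} {j} Ls Lt (p₀ , p₁ , p₂) (q₀ , q₁ , q₂) =
    local-determined T Ls Lt i j (trans p₀ (sym q₀)) (trans p₁ (sym q₁)) (trans p₂ (sym q₂))

  record Diamond (u v : V) : Set where
    constructor diamond
    field
      left-face right-face : Face
      left-apex right-apex : V
      left≢right : left-face ≢ right-face
      left  : Triangle T left-face u v left-apex
      right : Triangle T right-face u v right-apex

  Diamond-swap : ∀ {u v} → Diamond u v → Diamond u v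
  Diamond-swap (diamond f g c d f≢g tf tg) = diamond g f d c (≢-sym f≢g) tg tf

  Diamond-flip : ∀ {u v} → Diamond u v → Diamond v u
  Diamond-flip (diamond f g c d f≢g tf tg) = diamond f g c d f≢g (Triangle-flip T tf) (Triangle-flip T tg)

  Adj⇒Diamond : ∀ {u v} → Adj u v → Diamond u v
  Adj⇒Diamond (u≢v , f , u∈f , v∈f) with third-vertex T f u∈f v∈f u≢v
  ... | c , tf with opposite-triangle T tf
  ...   | g , f≢g , d , tg = diamond f g c d f≢g tf tg

  module _ {u v} (D : Diamond u v) where
    open Diamond D renaming (left-apex to c; right-apex to d)

    apex-either : ∀ {h x} → Triangle T h u v x → x ≡ c ⊎ x ≡ d
    apex-either th@(triangle u∈h v∈h _ _ _ _)
      with faces-on-edge T (Triangle.a≢b left) left≢right (Triangle.a∈f left) (Triangle.b∈f left)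
                           (Triangle.a∈f right) (Triangle.b∈f right) u∈h v∈h
    ... | inj₁ refl = inj₁ (Triangle-apex-unique T th left)
    ... | inj₂ refl = inj₂ (Triangle-apex-unique T th right)

    module _ {s : ℤ → V} (Ls : LocalZigzag T s) (a : ℤ) where

      next-is-apex : s a ≡ u → s (a ℤ.+ + 1) ≡ v → s (a ℤ.+ + 2) ≡ c ⊎ s (a ℤ.+ + 2) ≡ d
      next-is-apex e₀ e₁ with Ls a
      ... | _ , _ , _ , tf , _ , _ = apex-either (Triangle-subst T e₀ e₁ refl (Triangle-rotate T (Triangle-rotate T tf)))

      prev-is-other-apex : s (a ℤ.+ + 1) ≡ u → s (a ℤ.+ + 2) ≡ v → s (a ℤ.+ + 3) ≡ c → s a ≡ d
      prev-is-other-apex e₁ e₂ e₃ with Ls a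
      ... | _ , _ , _ , tf , _ , s₀≢s₃ with apex-either (Triangle-subst T e₁ e₂ refl tf)
      ...   | inj₁ s₀≡c = ⊥-elim (s₀≢s₃ (trans s₀≡c (sym e₃)))
      ...   | inj₂ s₀≡d = s₀≡d

      next-is-other-apex : s a ≡ c → s (a ℤ.+ + 1) ≡ u → s (a ℤ.+ + 2) ≡ v → s (a ℤ.+ + 3) ≡ d
      next-is-other-apex e₀ e₁ e₂ with Ls a
      ... | _ , _ , _ , _ , tg , s₀≢s₃ with apex-either (Triangle-subst T e₁ e₂ refl tg)
      ...   | inj₁ s₃≡c = ⊥-elim (s₀≢s₃ (trans e₀ (sym s₃≡c)))
      ...   | inj₂ s₃≡d = s₃≡d

module _ (T : Triangulation) (τ : ZOrientation T) where
  open Triangulation T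
  open ZOrientation τ

  private
    Zᵏ : Fin (length zs) → Zigzag T
    Zᵏ = lookup zs

    seqᵏ : Fin (length zs) → ℤ → V
    seqᵏ k = Zigzag.seq (Zᵏ k)

    lenᵏ : Fin (length zs) → ℕ
    lenᵏ k = Zigzag.len (Zᵏ k)

    local : (Z : Zigzag T) → LocalZigzag T (Zigzag.seq Z)
    local Z = isZigzag⇒local T (Zigzag.isZigzag Z)

  visits-in : Zigzag T → V → V → V → ℕ
  visits-in Z x y w = countBelow (λ i → Visits? T (Zigzag.seq Z) (+ i) x y w) (Zigzag.len Z)

  visits : V → V → V → ℕ
  visits x y w = sum (map (λ Z → visits-in Z x y w) zs)

  InOr-self : ∀ k → InOr (seqᵏ k)
  InOr-self k = lookup⇒Any {P = λ Z → SameCyclic T (Zigzag.seq Z) (seqᵏ k)} zs k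
    (+ 0 , λ i → cong (seqᵏ k) (sym (ℤP.+-identityʳ i)))

  visit-unique : ∀ k k′ {i j x y w} → i < lenᵏ k → j < lenᵏ k′ →
    Visits T (seqᵏ k) (+ i) x y w → Visits T (seqᵏ k′) (+ j) x y w → k ≡ k′ × i ≡ j
  visit-unique k k′ {i} {j} i<len j<len p q = compare (k ≟ k′) (Visits-determined T (local (Zᵏ k)) (local (Zᵏ k′)) p q)
    where
      compare : Dec (k ≡ k′) → (∀ m → seqᵏ k (+ i ℤ.+ m) ≡ seqᵏ k′ (+ j ℤ.+ m)) → k ≡ k′ × i ≡ j
      compare (no k≢k′) agree =
        ⊥-elim (no-dup k k′ k≢k′ (agreement⇒SameCyclic T {s = seqᵏ k} {t = seqᵏ k′} (+ i) (+ j) agree))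
      compare (yes refl) agree with ℕP.<-cmp i j
      ... | tri≈ _ i≡j _ = refl , i≡j
      ... | tri< i<j _ _ = ⊥-elim (zigzag-no-shorter-shift T (Zᵏ k) i<j j<len agree)
      ... | tri> _ _ j<i = ⊥-elim (zigzag-no-shorter-shift T (Zᵏ k) j<i i<len λ m → sym (agree m))

  traversal⇒trav-pos : ∀ k {j x y} → seqᵏ k j ≡ x → seqᵏ k (j ℤ.+ + 1) ≡ y → 0 < trav T τ x y
  traversal⇒trav-pos k {j} {x} {y} e₀ e₁ with zigzag-index-mod T (Zᵏ k) j
  ... | i , i<len , agree = ℕP.<-≤-trans
    (subst (0 <_) (sym (length-filter-upTo _ (lenᵏ k)))
      (countBelow-pos _ i<len (trans (cong (seqᵏ k) (sym (ℤP.+-identityʳ (+ i))))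
                                 (trans (agree (+ 0)) (trans (cong (seqᵏ k) (ℤP.+-identityʳ j)) e₀)) ,
                               trans (agree (+ 1)) e₁)))
    (lookup≤sum-map zs (λ Z → steps T τ Z x y) k)

  trav-pos⇒Adj : ∀ {u v} → 0 < trav T τ u v → Adj u v
  trav-pos⇒Adj {u} {v} pos with sum-map-pos zs (λ Z → steps T τ Z u v) pos
  ... | k , steps>0 with countBelow-witness _ (lenᵏ k) (subst (0 <_) (length-filter-upTo _ (lenᵏ k)) steps>0)
  ...   | i , _ , e₀ , e₁ = subst₂ Adj e₀ e₁ (IsZigzag.edges (Zigzag.isZigzag (Zᵏ k)) (+ i))

  module _ (nd : NonDegenerate T) where

    corner-in-τ : ∀ (cr : Corner T) →
        (∃[ k ] ∃[ j ] Visits T (seqᵏ k) j (c₀ cr) (c₁ cr) (c₂ cr))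
      ⊎ (∃[ k ] ∃[ j ] Visits T (seqᵏ k) j (c₂ cr) (c₁ cr) (c₀ cr))
    corner-in-τ cr with corner-on-zigzag T nd cr
    ... | W , w₀ , w₁ , w₂ with proj₁ (choice W)
    ... | inj₁ W∈τ with Any⇒lookup W∈τ
    ...   | k , j , same = inj₁ (k , j ,
      trans (cong (seqᵏ k) (sym (ℤP.+-identityˡ j))) (trans (sym (same (+ 0))) w₀) ,
      trans (cong (seqᵏ k) (ℤP.+-comm j (+ 1))) (trans (sym (same (+ 1))) w₁) ,
      trans (cong (seqᵏ k) (ℤP.+-comm j (+ 2))) (trans (sym (same (+ 2))) w₂))
    corner-in-τ cr | W , w₀ , w₁ , w₂ | inj₂ W⁻¹∈τ with Any⇒lookup W⁻¹∈τ
    ...   | k , j , same = inj₂ (k , j ℤ.+ -[1+ 1 ] ,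
      trans (cong (seqᵏ k) (ℤP.+-comm j -[1+ 1 ])) (trans (sym (same -[1+ 1 ])) w₂) ,
      trans (cong (seqᵏ k) (ℓ₁ j)) (trans (sym (same -[1+ 0 ])) w₁) ,
      trans (cong (seqᵏ k) (ℓ₂ j)) (trans (sym (same (+ 0))) w₀))
      where
        ℓ₁ : ∀ j → (j ℤ.+ -[1+ 1 ]) ℤ.+ + 1 ≡ -[1+ 0 ] ℤ.+ j
        ℓ₁ = solve-∀
        ℓ₂ : ∀ j → (j ℤ.+ -[1+ 1 ]) ℤ.+ + 2 ≡ + 0 ℤ.+ j
        ℓ₂ = solve-∀

    module _ {u v} (D : Diamond T u v) where
      open Diamond D renaming (left-apex to c; right-apex to d)

      private
        u≢v : u ≢ v
        u≢v = Triangle.a≢b left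

        c≢d : c ≢ d
        c≢d = nd left≢right left right

      trav-split : trav T τ u v ≡ visits u v c + visits u v d
      trav-split = begin
        trav T τ u v                                                ≡⟨ sum-map-cong zs split-in ⟩
        sum (map (λ Z → visits-in Z u v c + visits-in Z u v d) zs)  ≡⟨ sum-map-+ zs _ _ ⟩
        visits u v c + visits u v d                                 ∎
        where
          open ≡-Reasoning
          split-in : ∀ Z → steps T τ Z u v ≡ visits-in Z u v c + visits-in Z u v d
          split-in Z = trans (length-filter-upTo _ (Zigzag.len Z))
            (countBelow-split _ (λ i → Visits? T s (+ i) u v c) (λ i → Visits? T s (+ i) u v d)
              continue (λ (e₀ , e₁ , _) → e₀ , e₁) (λ (e₀ , e₁ , _) → e₀ , e₁)
              (λ (_ , _ , e) (_ , _ , e′) → c≢d (trans (sym e) e′)) (Zigzag.len Z))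
            where
              s = Zigzag.seq Z
              continue : ∀ {i} → s (+ i) ≡ u × s (+ i ℤ.+ + 1) ≡ v → Visits T s (+ i) u v c ⊎ Visits T s (+ i) u v d
              continue {i} (e₀ , e₁) with next-is-apex T D (local Z) (+ i) e₀ e₁
              ... | inj₁ e = inj₁ (e₀ , e₁ , e)
              ... | inj₂ e = inj₂ (e₀ , e₁ , e)

      opposite-visits-exclusive : ∀ k k′ {i j} → Visits T (seqᵏ k) i u v c → Visits T (seqᵏ k′) j v u d → ⊥
      opposite-visits-exclusive k k′ {i} {j} (p₀ , p₁ , p₂) q =
        proj₂ (choice (Zᵏ k)) (InOr-self k ,
          lookup⇒Any {P = λ Z → SameCyclic T (Zigzag.seq Z) (reverseSeq T s)} zs k′
            (agreement⇒SameCyclic T {s = seqᵏ k′} {t = reverseSeq T s} j (ℤ.- (i ℤ.+ + 1)) λ m → sym (agree m)))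
        where
          s = seqᵏ k
          ℓ₁ : ∀ i → (i ℤ.+ -[1+ 0 ]) ℤ.+ + 1 ≡ i
          ℓ₁ = solve-∀
          ℓ₂ : ∀ i → (i ℤ.+ -[1+ 0 ]) ℤ.+ + 2 ≡ i ℤ.+ + 1
          ℓ₂ = solve-∀
          ℓ₃ : ∀ i → (i ℤ.+ -[1+ 0 ]) ℤ.+ + 3 ≡ i ℤ.+ + 2
          ℓ₃ = solve-∀
          r₀ : ∀ i → ℤ.- (ℤ.- (i ℤ.+ + 1)) ≡ i ℤ.+ + 1
          r₀ = solve-∀
          r₁ : ∀ i → ℤ.- (ℤ.- (i ℤ.+ + 1) ℤ.+ + 1) ≡ i
          r₁ = solve-∀
          r₂ : ∀ i → ℤ.- (ℤ.- (i ℤ.+ + 1) ℤ.+ + 2) ≡ i ℤ.+ -[1+ 0 ]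
          r₂ = solve-∀
          d-before : s (i ℤ.+ -[1+ 0 ]) ≡ d
          d-before = prev-is-other-apex T D (local (Zᵏ k)) (i ℤ.+ -[1+ 0 ])
            (trans (cong s (ℓ₁ i)) p₀) (trans (cong s (ℓ₂ i)) p₁) (trans (cong s (ℓ₃ i)) p₂)
          reversed : Visits T (reverseSeq T s) (ℤ.- (i ℤ.+ + 1)) v u d
          reversed = trans (cong s (r₀ i)) p₁ , trans (cong s (r₁ i)) p₀ , trans (cong s (r₂ i)) d-before
          agree : ∀ m → reverseSeq T s (ℤ.- (i ℤ.+ + 1) ℤ.+ m) ≡ seqᵏ k′ (j ℤ.+ m)
          agree = Visits-determined T (reverse-local T (local (Zᵏ k))) (local (Zᵏ k′)) reversed q

      private
        Either : Zigzag T → ℕ → Set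
        Either Z i = Visits T (Zigzag.seq Z) (+ i) u v c ⊎ Visits T (Zigzag.seq Z) (+ i) v u d

        Either? : ∀ Z i → Dec (Either Z i)
        Either? Z i = Visits? T (Zigzag.seq Z) (+ i) u v c ⊎-dec Visits? T (Zigzag.seq Z) (+ i) v u d

        Either-unique : ∀ k k′ {i j} → i < lenᵏ k → j < lenᵏ k′ →
          Either (Zᵏ k) i → Either (Zᵏ k′) j → k ≡ k′ × i ≡ j
        Either-unique k k′ i<len j<len (inj₁ p) (inj₁ q) = visit-unique k k′ i<len j<len p q
        Either-unique k k′ i<len j<len (inj₂ p) (inj₂ q) = visit-unique k k′ i<len j<len p q
        Either-unique k k′ _     _     (inj₁ p) (inj₂ q) = ⊥-elim (opposite-visits-exclusive k k′ p q)
        Either-unique k k′ _     _     (inj₂ p) (inj₁ q) = ⊥-elim (opposite-visits-exclusive k′ k q p)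

        Either-same-zigzag : ∀ k k′ → 0 < countBelow (Either? (Zᵏ k)) (lenᵏ k) →
          0 < countBelow (Either? (Zᵏ k′)) (lenᵏ k′) → k ≡ k′
        Either-same-zigzag k k′ pos pos′ with countBelow-witness _ _ pos | countBelow-witness _ _ pos′
        ... | i , i<len , p | j , j<len , q = proj₁ (Either-unique k k′ i<len j<len p q)

        Either-exists : ∃[ k ] (0 < countBelow (Either? (Zᵏ k)) (lenᵏ k))
        Either-exists with corner-in-τ (corner u v c left-face (Triangle-rotate T left))
        ... | inj₁ (k , j , vis) with Visits-mod T (Zᵏ k) vis
        ...   | i , i<len , vis′ = k , countBelow-pos _ i<len (inj₁ vis′)
        Either-exists | inj₂ (k , j , (e₀ , e₁ , e₂)) with Visits-mod T (Zᵏ k) {j = j ℤ.+ + 1} vis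
          where
            s = seqᵏ k
            vis : Visits T s (j ℤ.+ + 1) v u d
            vis = e₁ , trans (cong s (ℤP.+-assoc j (+ 1) (+ 1))) e₂ ,
                  trans (cong s (ℤP.+-assoc j (+ 1) (+ 2))) (next-is-other-apex T (Diamond-flip T D) (local (Zᵏ k)) j e₀ e₁ e₂)
        ...   | i , i<len , vis′ = k , countBelow-pos _ i<len (inj₂ vis′)

      -- A zigzag through u v c passes d u v c, and its reverse passes v u d; τ holds one of the two.
      visits-opposite : visits u v c + visits v u d ≡ 1
      visits-opposite = begin
        visits u v c + visits v u d                                 ≡⟨ sum-map-+ zs _ _ ⟨
        sum (map (λ Z → visits-in Z u v c + visits-in Z v u d) zs)  ≡⟨ sum-map-cong zs merge ⟨
        sum (map (λ Z → countBelow (Either? Z) (Zigzag.len Z)) zs)   ≡⟨ sum-map-≡1 zs _ at-most-one Either-same-zigzag Either-exists ⟩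
        1                                                            ∎
        where
          open ≡-Reasoning
          merge : ∀ Z → countBelow (Either? Z) (Zigzag.len Z) ≡ visits-in Z u v c + visits-in Z v u d
          merge Z = countBelow-split (Either? Z) _ _ (λ e → e) inj₁ inj₂
            (λ p q → u≢v (trans (sym (proj₁ p)) (proj₁ q))) (Zigzag.len Z)
          at-most-one : ∀ k → countBelow (Either? (Zᵏ k)) (lenᵏ k) ≤ 1
          at-most-one k = countBelow-≤1 _ (lenᵏ k) λ i<len j<len p q → proj₂ (Either-unique k k i<len j<len p q)

    Adj⇒trav-sum : ∀ {u v} → Adj u v → trav T τ u v + trav T τ v u ≡ 2
    Adj⇒trav-sum {u} {v} adj = begin
      trav T τ u v + trav T τ v u
        ≡⟨ cong₂ _+_ (trav-split D) (trav-split (Diamond-flip T D)) ⟩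
      (visits u v c + visits u v d) + (visits v u c + visits v u d)
        ≡⟨ cong (_+_ (visits u v c + visits u v d)) (ℕP.+-comm (visits v u c) _) ⟩
      (visits u v c + visits u v d) + (visits v u d + visits v u c)
        ≡⟨ +-interchange (visits u v c) _ _ _ ⟩
      (visits u v c + visits v u d) + (visits u v d + visits v u c)
        ≡⟨ cong₂ _+_ (visits-opposite D) (visits-opposite (Diamond-swap T D)) ⟩
      2 ∎
      where
        open ≡-Reasoning
        D : Diamond T u v
        D = Adj⇒Diamond T adj
        c d : V
        c = Diamond.left-apex D
        d = Diamond.right-apex D

    trav-pos⇒Arc : ∀ {u v} → 0 < trav T τ u v → Arc T τ u v
    trav-pos⇒Arc pos = m+n≡2-cases (Adj⇒trav-sum (trav-pos⇒Adj pos)) pos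

    visit⇒arcs : ∀ k {j x y w} → Visits T (seqᵏ k) j x y w → Arc T τ x y × Arc T τ y w
    visit⇒arcs k {j} (e₀ , e₁ , e₂) = trav-pos⇒Arc (traversal⇒trav-pos k e₀ e₁) ,
      trav-pos⇒Arc (traversal⇒trav-pos k e₁ (trans (cong (seqᵏ k) (ℤP.+-assoc j (+ 1) (+ 1))) e₂))

    corner-arcs : (cr : Corner T) →
      (Arc T τ (c₀ cr) (c₁ cr) × Arc T τ (c₁ cr) (c₂ cr)) ⊎ (Arc T τ (c₂ cr) (c₁ cr) × Arc T τ (c₁ cr) (c₀ cr))
    corner-arcs cr with corner-in-τ cr
    ... | inj₁ (k , _ , vis) = inj₁ (visit⇒arcs k vis)
    ... | inj₂ (k , _ , vis) = inj₂ (visit⇒arcs k vis)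

module _ (T : Triangulation) (τ : ZOrientation T) where
  open Triangulation T
  open ZOrientation τ

  Arc? : ∀ u v → Dec (Arc T τ u v)
  Arc? u v =     ((trav T τ u v ℕ.≟ 1) ×-dec (trav T τ v u ℕ.≟ 1))
            ⊎-dec ((trav T τ u v ℕ.≟ 2) ×-dec (trav T τ v u ℕ.≟ 0))

  private
    weight-pos⇒ : ∀ a b → 0 < (if (a ≡ᵇ 1) ∧ (b ≡ᵇ 1) then 1 else if (a ≡ᵇ 2) ∧ (b ≡ᵇ 0) then 2 else 0) →
      (a ≡ 1 × b ≡ 1) ⊎ (a ≡ 2 × b ≡ 0)
    weight-pos⇒ (suc zero)       (suc zero) _ = inj₁ (refl , refl)
    weight-pos⇒ (suc (suc zero)) zero       _ = inj₂ (refl , refl)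
    weight-pos⇒ zero                   _             ()
    weight-pos⇒ (suc zero)             zero          ()
    weight-pos⇒ (suc zero)             (suc (suc _)) ()
    weight-pos⇒ (suc (suc zero))       (suc _)       ()
    weight-pos⇒ (suc (suc (suc _)))    _             ()

  Arc⇒weight-pos : ∀ {u v} → Arc T τ u v → 0 < weight T τ u v
  Arc⇒weight-pos {u} {v} arc with trav T τ u v | trav T τ v u | arc
  ... | .1 | .1 | inj₁ (refl , refl) = ℕP.0<1+n
  ... | .2 | .0 | inj₂ (refl , refl) = ℕP.0<1+n

  Arc⇒Trans : ∀ {u v} → Arc T τ u v → Trans T τ u v
  Arc⇒Trans {u} {v} arc with deg T τ u in deg≡
  ... | zero  = ⊥-elim (ℕP.<⇒≱ (Arc⇒weight-pos arc) (subst (weight T τ u v ≤_) deg≡ weight≤deg))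
    where
      weight≤deg : weight T τ u v ≤ deg T τ u
      weight≤deg = ∈⇒≤sum-map (weight T τ u) (∈-allFin v)
  ... | suc k = ℚP.positive⁻¹ _ {{ℚP.normalize-pos (weight T τ u v) (suc k) {{_}} {{ℕ.>-nonZero (Arc⇒weight-pos arc)}}}}

  Trans⇒Arc : ∀ {u v} → Trans T τ u v → Arc T τ u v
  Trans⇒Arc {u} {v} t with deg T τ u
  ... | zero  = ⊥-elim (ℚP.<-irrefl refl t)
  ... | suc k = weight-pos⇒ (trav T τ u v) (trav T τ v u) (numerator-pos (weight T τ u v) t)
    where
      numerator-pos : ∀ w → 0ℚ ℚ.< + w ℚ./ suc k → 0 < w
      numerator-pos zero    0<0 = ⊥-elim (ℚP.<-irrefl (sym (ℚP.0/n≡0 (suc k))) 0<0)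
      numerator-pos (suc w) _   = ℕP.0<1+n

  Arc⇒nonDegenerate : ∀ {u v} → Arc T τ u v → NonDegenerate T
  Arc⇒nonDegenerate {u} {v} arc with sum-map-pos zs (λ Z → steps T τ Z u v) (traversed arc)
    where
      traversed : Arc T τ u v → 0 < trav T τ u v
      traversed (inj₁ (t≡1 , _)) = subst (0 <_) (sym t≡1) ℕP.0<1+n
      traversed (inj₂ (t≡2 , _)) = subst (0 <_) (sym t≡2) ℕP.0<1+n
  ... | k , _ = local⇒nonDegenerate T (isZigzag⇒local T (Zigzag.isZigzag (lookup zs k)))

  module _ (nd : NonDegenerate T) where

    face-cycle : ∀ h → ∃[ x ] ∃[ y ] ∃[ z ] (Cycle3 {R = Arc T τ} x y z × (∀ {v} → v ∈F h → Among3 v x y z))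
    face-cycle h with corner-arcs T τ nd (corner a b c h t₀) | corner-arcs T τ nd (corner b c a h t₁)
                    | corner-arcs T τ nd (corner c a b h t₂)
      where
        a b c : V
        a = fa h
        b = fb h
        c = fc h
        t₀ : Triangle T h b c a
        t₀ = proj₂ (third-vertex T h (inj₂ (inj₁ refl)) (inj₂ (inj₂ refl)) (proj₁ (proj₂ (face-distinct h))))
        t₁ : Triangle T h c a b
        t₁ = Triangle-rotate T t₀
        t₂ : Triangle T h a b c
        t₂ = Triangle-rotate T t₁
    ... | inj₁ (a→b , b→c) | inj₁ (_ , c→a)   | _               = fa h , fb h , fc h , (a→b , b→c , c→a) , λ v∈ → v∈
    ... | inj₁ (a→b , b→c) | inj₂ _           | inj₁ (c→a , _)  = fa h , fb h , fc h , (a→b , b→c , c→a) , λ v∈ → v∈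
    ... | inj₁ _           | inj₂ (a→c , c→b) | inj₂ (b→a , _)  = fa h , fc h , fb h , (a→c , c→b , b→a) , among3-swap
    ... | inj₂ (c→b , b→a) | inj₁ (b→c , c→a) | inj₁ (_ , a→b)  = fa h , fb h , fc h , (a→b , b→c , c→a) , λ v∈ → v∈
    ... | inj₂ (c→b , b→a) | inj₁ _           | inj₂ (_ , a→c)  = fa h , fc h , fb h , (a→c , c→b , b→a) , among3-swap
    ... | inj₂ (c→b , b→a) | inj₂ (a→c , _)   | _               = fa h , fc h , fb h , (a→c , c→b , b→a) , among3-swap


    arc-reachable : ∀ u v → ∃[ ℓ ] Walk (Arc T τ) u v ℓ
    arc-reachable u v = along (connected u v)
      where
        along : ∀ {u v} → Star Adj u v → ∃[ ℓ ] Walk (Arc T τ) u v ℓ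
        along ε = 0 , []
        along ((_ , h , u∈h , w∈h) ◅ path) with face-cycle h | along path
        ... | _ , _ , _ , cyc , among | ℓ′ , q =
          let (ℓ , p) = cycle-reach cyc (among u∈h) (among w∈h) in ℓ + ℓ′ , p ++ᵂ q

    closed-walk-3 : ∀ v → Walk (Arc T τ) v v 3
    closed-walk-3 v with vertex-on-face v
    ... | h , v∈h with face-cycle h
    ...   | _ , _ , _ , cyc , among = cycle-closed cyc (among v∈h)

    nonDegenerate⇒irreducible : Irreducible T τ
    nonDegenerate⇒irreducible u v = let (ℓ , p) = arc-reachable u v in ℓ , mapᵂ Arc⇒Trans p

    non3-closed-walk⇒aperiodic : ∀ {v ℓ} → Walk (Arc T τ) v v ℓ → ¬ 3 ∣ ℓ → Aperiodic T τ
    non3-closed-walk⇒aperiodic w 3∤ℓ x = (λ m _ → 1∣ m) , λ d d∣closed →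
      ∣prime∧∣∧prime∤⇒∣1 prime[3] (d∣closed 3 (ℕP.0<1+n , mapᵂ Arc⇒Trans (closed-walk-3 x)))
        (closed-walk-divisor-transfer nonDegenerate⇒irreducible d∣closed (mapᵂ Arc⇒Trans w)) 3∤ℓ
      where
        prime[3] : Prime 3
        prime[3] = toWitness {a? = prime? 3} _

  private
    v₀ : V
    v₀ = F.fromℕ< nonempty

  aperiodic⇒ergodic : Aperiodic T τ → Ergodic T τ
  aperiodic⇒ergodic aperiodic with FP.any? (λ u → FP.any? (λ v → Arc? u v))
  ... | yes (_ , _ , arc) = nonDegenerate⇒irreducible (Arc⇒nonDegenerate arc) , aperiodic
  ... | no no-arc = ⊥-elim (1≢0 (0∣⇒≡0 (proj₂ (aperiodic v₀) 0 no-closed-walk)))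
    where
      -- With no arcs the set of closed-walk lengths is empty, and its gcd is 0.
      no-closed-walk : ∀ ℓ → ClosedLen T τ v₀ ℓ → 0 ∣ ℓ
      no-closed-walk (suc _) (_ , t ∷ _) = ⊥-elim (no-arc (v₀ , _ , Trans⇒Arc t))
      1≢0 : 1 ≢ 0
      1≢0 ()

  non3⇒ergodic : HasNon3ClosedWalk T τ → Ergodic T τ
  non3⇒ergodic (_ , zero , _ , 3∤0) = ⊥-elim (3∤0 (3 ∣0))
  non3⇒ergodic (_ , suc _ , w@(arc ∷ _) , 3∤ℓ) =
    nonDegenerate⇒irreducible nd , non3-closed-walk⇒aperiodic nd w 3∤ℓ
    where
      nd : NonDegenerate T
      nd = Arc⇒nonDegenerate arc

  ergodic⇒non3 : Ergodic T τ → HasNon3ClosedWalk T τ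
  ergodic⇒non3 (irreducible , aperiodic) with closed-walk-lengths-mod Arc? arc-reachable′ 3 v₀
    where
      arc-reachable′ : ∀ u v → ∃[ ℓ ] Walk (Arc T τ) u v ℓ
      arc-reachable′ u v = let (ℓ , p) = irreducible u v in ℓ , mapᵂ Trans⇒Arc p
  ... | inj₁ non3     = non3
  ... | inj₂ 3∣closed = ⊥-elim (3≢1 (∣1⇒≡1 (proj₂ (aperiodic v₀) 3 λ _ (_ , w) → 3∣closed (mapᵂ Trans⇒Arc w))))
    where
      3≢1 : 3 ≢ 1
      3≢1 ()

proposition2 : (T : Triangulation) (τ : ZOrientation T) →
    (Aperiodic T τ ⇔ Ergodic T τ) × (Ergodic T τ ⇔ HasNon3ClosedWalk T τ)
proposition2 T τ = mk⇔ (aperiodic⇒ergodic T τ) proj₂ , mk⇔ (ergodic⇒non3 T τ) (non3⇒ergodic T τ)
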